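{- Let $n\ge1$ and let $f_1,f_2\in\mathbb{F}_q[x,y]$ be coprime homogeneous polynomials of degree $n$ of the forms $$f_1(x,y)=a_1x^n+a_2x^{n-1}y+\cdots+a_nxy^{n-1},\qquad f_2(x,y)=b_1x^n+b_2x^{n-1}y+\cdots+b_nxy^{n-1}+b_{n+1}y^n.$$ If $\gcd(n,q-1)=1$, then $(f_1(x,y),f_2(x,y))$ is a permutation of $\mathbb{F}_q^2$ if and only if $\frac{f_1(1,t)}{f_2(1,t)}$ is a degree-$n$ rational function that permutes $\mathbb{P}^1(\mathbb{F}_q)=\mathbb{F}_q\cup\{\infty\}$.
   Context: A system $(f_1,f_2)$ with $f_i\in\mathbb{F}_q[x,y]$ is a permutation of $\mathbb{F}_q^2$ if for every $(u,v)\in\mathbb{F}_q^2$ the system $f_1(x,y)=u$, $f_2(x,y)=v$ has exactly one solution in $\mathbb{F}_q^2$. For a nonconstant rational function $f=P/Q\in\mathbb{F}_q(t)$ with $P,Q$ coprime, $\deg f=\max\{\deg P,\deg Q\}$; $f$ induces a map $\mathbb{P}^1(\mathbb{F}_q)\to\mathbb{P}^1(\mathbb{F}_q)$ in the usual way, and $f$ permutes $\mathbb{P}^1(\mathbb{F}_q)$ if this map is a bijection. -}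

module Defs where

open import Level using (0ℓ)
open import Data.Nat using (ℕ; zero; suc; _⊔_; _<_; _∸_; _≡ᵇ_; _<ᵇ_)
open import Data.Nat.GCD using (gcd)
open import Data.Fin using (Fin; toℕ)
open import Data.Bool using (Bool; true; false; if_then_else_; _∧_)
open import Data.List using (List; []; _∷_; map; foldr; concatMap; allFin)
open import Data.Maybe using (Maybe; just; nothing)
open import Data.Product using (Σ; ∃; ∃-syntax; _×_; _,_)
open import Relation.Nullary using (¬_; Dec; yes; no)
open import Relation.Binary.PropositionalEquality using (_≡_)
open import Relation.Binary.Definitions using (DecidableEquality)
open import Algebra.Structures using (IsCommutativeRing)
open import Function.Definitions using (Bijective)
open import Function.Bundles using (_↔_)

record FiniteField : Set₁ where
  infixl 7 _*_
  infixl 6 _+_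
  field
    F     : Set
    _+_   : F → F → F
    _*_   : F → F → F
    -_    : F → F
    0#    : F
    1#    : F
    _⁻¹   : F → F          -- value at 0# is irrelevant
    isCommutativeRing : IsCommutativeRing _≡_ _+_ _*_ -_ 0# 1#
    0≢1   : ¬ (0# ≡ 1#)
    inverseʳ : ∀ x → ¬ (x ≡ 0#) → x * (x ⁻¹) ≡ 1#
    _≟_   : DecidableEquality F
    q     : ℕ
    enum  : Fin q ↔ F

module FieldTheory (𝔽 : FiniteField) where
  open FiniteField 𝔽

  isZero : F → Bool
  isZero x with x ≟ 0#
  ... | yes _ = true
  ... | no  _ = false

  sumF : List F → F
  sumF = foldr _+_ 0#

  _^_ : F → ℕ → F
  x ^ zero  = 1#
  x ^ suc k = x * (x ^ k)

  -- Polynomials in F[x,y], as finite lists of terms c·x^i·y^j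
  -- (representation not unique; all notions go through coefficients).
  Poly2 : Set
  Poly2 = List (F × ℕ × ℕ)

  coeff2 : Poly2 → ℕ → ℕ → F
  coeff2 p i j = sumF (map (λ { (c , a , b) → if (a ≡ᵇ i) ∧ (b ≡ᵇ j) then c else 0# }) p)

  eval2 : Poly2 → F → F → F
  eval2 p x y = sumF (map (λ { (c , a , b) → c * (x ^ a) * (y ^ b) }) p)

  mul2 : Poly2 → Poly2 → Poly2
  mul2 g h = concatMap (λ { (c , i , j) → map (λ { (d , k , l) → (c * d , i Data.Nat.+ k , j Data.Nat.+ l) }) h }) g

  _∣₂_ : Poly2 → Poly2 → Set
  g ∣₂ f = ∃[ h ] (∀ i j → coeff2 f i j ≡ coeff2 (mul2 g h) i j)

  Coprime2 : Poly2 → Poly2 → Set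
  Coprime2 f g = ∀ d → d ∣₂ f → d ∣₂ g →
    ∀ i j → ¬ (coeff2 d i j ≡ 0#) → (i Data.Nat.+ j) ≡ 0

  homPoly : (n m : ℕ) → (Fin m → F) → Poly2
  homPoly n m c = map (λ k → (c k , n ∸ toℕ k , toℕ k)) (allFin m)

  UPoly : Set
  UPoly = List (F × ℕ)

  coeffU : UPoly → ℕ → F
  coeffU p e = sumF (map (λ { (c , a) → if a ≡ᵇ e then c else 0# }) p)

  evalU : UPoly → F → F
  evalU p t = sumF (map (λ { (c , a) → c * (t ^ a) }) p)

  mulU : UPoly → UPoly → UPoly
  mulU g h = concatMap (λ { (c , i) → map (λ { (d , k) → (c * d , i Data.Nat.+ k) }) h }) g

  -- degree (the zero polynomial gets degree 0) and leading coefficient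
  degU : UPoly → ℕ
  degU p = foldr (λ { (_ , e) acc → if isZero (coeffU p e) then acc else e ⊔ acc }) 0 p

  leadU : UPoly → F
  leadU p = coeffU p (degU p)

  NonZeroU : UPoly → Set
  NonZeroU p = ∃[ e ] ¬ (coeffU p e ≡ 0#)

  _∣U_ : UPoly → UPoly → Set
  g ∣U f = ∃[ h ] (∀ e → coeffU f e ≡ coeffU (mulU g h) e)

  CoprimeU : UPoly → UPoly → Set
  CoprimeU f g = ∀ d → d ∣U f → d ∣U g → degU d ≡ 0

  -- f(1,t) for f ∈ F[x,y]
  dehom : Poly2 → UPoly
  dehom = map (λ { (c , i , j) → (c , j) })

  ReducedForm : UPoly → UPoly → UPoly → UPoly → Set
  ReducedForm P Q P' Q' =
    NonZeroU Q' × CoprimeU P' Q' × (∀ e → coeffU (mulU P Q') e ≡ coeffU (mulU P' Q) e)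

  -- P^1(F) = F ∪ {∞}, with ∞ = nothing
  P1 : Set
  P1 = Maybe F

  -- the map P^1(F) → P^1(F) induced by a reduced fraction P'/Q'
  induced : UPoly → UPoly → P1 → P1
  induced P Q (just t) with evalU Q t ≟ 0#
  ... | yes _ = nothing
  ... | no  _ = just (evalU P t * (evalU Q t) ⁻¹)
  induced P Q nothing with degU Q <ᵇ degU P | degU P <ᵇ degU Q
  ... | true  | _     = nothing
  ... | false | true  = just 0#
  ... | false | false = just (leadU P * (leadU Q) ⁻¹)

  DegreePermutesP1 : ℕ → UPoly → UPoly → Set
  DegreePermutesP1 d P Q = ∃[ P' ] ∃[ Q' ]
    (ReducedForm P Q P' Q' × (degU P' ⊔ degU Q') ≡ d × Bijective _≡_ _≡_ (induced P' Q'))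

  PermutesPlane : Poly2 → Poly2 → Set
  PermutesPlane f1 f2 = ∀ u v → ∃[ xy ]
    ((eval2 f1 (Data.Product.proj₁ xy) (Data.Product.proj₂ xy) ≡ u ×
      eval2 f2 (Data.Product.proj₁ xy) (Data.Product.proj₂ xy) ≡ v) ×
     (∀ x y → eval2 f1 x y ≡ u → eval2 f2 x y ≡ v → (x , y) ≡ xy))

{-# OPTIONS --safe #-}
module Submission where

-- Put P = f₁(1, t) and Q = f₂(1, t). By homogeneity fᵢ(x, y) = xⁿ fᵢ(1, y/x) for x ≠ 0,
-- while f₁(0, y) = 0 and f₂(0, y) = b_{n+1} yⁿ with b_{n+1} ≠ 0 (else x divides f₁ and f₂).
-- So deg Q = n > deg P, P and Q inherit coprimality, and the plane map sends (x, y) with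
-- x ≠ 0 to a pair whose ratio in P¹ is (P/Q)(y/x).
-- (⇒) The preimages of (s, 1) and (1, 0) show that P/Q is onto, hence bijective on P¹.
-- (⇐) As P/Q is injective and sends ∞ to 0, P has no root in F, so f₁ vanishes only on
-- x = 0. Two points with the same image therefore both lie on x = 0, or on a common line
-- through the origin; either way some coordinates have equal n-th powers, and x ↦ xⁿ is
-- injective because gcd(n, q − 1) = 1 (Fermat and Bézout). Finally, an injective self-map
-- of the finite set F² is bijective.

open import Defs
open import Level using (0ℓ)
open import Data.Nat as ℕ using (ℕ; zero; suc; _≤_; _<_; _∸_; _⊔_; _≡ᵇ_; _<ᵇ_; z≤n; s≤s)
import Data.Nat.Properties as ℕ
open import Data.Nat.GCD using (gcd; gcd-GCD; GCD; module Bézout)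
open import Data.Fin as Fin using (Fin; zero; suc; toℕ; punchOut; punchIn)
open import Data.Fin.Properties using (¬Fin0; any?; punchOut-injective; punchInᵢ≢i; injective⇒≤; toℕ<n; *↔×)
open import Data.Fin.Permutation as Perm using (Permutation)
open import Data.Vec.Functional using (removeAt)
open import Data.Bool using (true; false; if_then_else_; _∧_)
open import Data.Bool.Properties using (T-≡; ¬-not)
open import Data.List using (List; []; _∷_; map; _++_; foldr; allFin)
import Data.List.Properties as List
open import Data.List.Relation.Unary.All as All using (All; []; _∷_)
import Data.List.Relation.Unary.All.Properties as All
open import Data.List.Relation.Unary.Any using (Any; here; there)
open import Data.Maybe using (Maybe; just; nothing)
import Data.Maybe.Properties as Maybe
open import Data.Product using (∃-syntax; _×_; _,_; proj₁; proj₂)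
open import Data.Product.Function.NonDependent.Propositional using (_×-↔_)
open import Data.Sum using (_⊎_; inj₁; inj₂)
open import Data.Empty using (⊥; ⊥-elim)
open import Relation.Nullary using (¬_; yes; no; contradiction)
open import Relation.Binary.Definitions using (tri<; tri≈; tri>)
open import Relation.Binary.PropositionalEquality
open import Function.Base using (_∘_)
open import Function.Bundles using (_↔_; _⇔_; Inverse; Equivalence; mk↔ₛ′; mk⇔)
open import Function.Definitions using (Injective; StrictlySurjective)
open import Function.Properties.Inverse using (↔-trans)
open import Function.Consequences.Propositional using (strictlySurjective⇒surjective)
open import Algebra.Bundles using (CommutativeRing)
open import Algebra.Structures using (IsCommutativeRing)
import Algebra.Properties.CommutativeMonoid.Sum as CommutativeMonoidSum
import Algebra.Properties.Semiring.Exp as SemiringExp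
import Algebra.Properties.CommutativeSemiring.Exp as CommutativeSemiringExp
open import Tactic.RingSolver using (solve-∀)
open import Tactic.RingSolver.Core.AlmostCommutativeRing using (AlmostCommutativeRing; fromCommutativeRing)

≡ᵇ-refl : ∀ a → (a ≡ᵇ a) ≡ true
≡ᵇ-refl a = Equivalence.to T-≡ (ℕ.≡⇒≡ᵇ a a refl)

≢⇒≡ᵇ-false : ∀ {a e} → a ≢ e → (a ≡ᵇ e) ≡ false
≢⇒≡ᵇ-false {a} {e} a≢e = ¬-not (a≢e ∘ ℕ.≡ᵇ⇒≡ a e ∘ Equivalence.from T-≡)

<⇒<ᵇ-true : ∀ {a e} → a < e → (a <ᵇ e) ≡ true
<⇒<ᵇ-true a<e = Equivalence.to T-≡ (ℕ.<⇒<ᵇ a<e)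

≮⇒<ᵇ-false : ∀ {a e} → ¬ a < e → (a <ᵇ e) ≡ false
≮⇒<ᵇ-false {a} {e} a≮e = ¬-not (a≮e ∘ ℕ.<ᵇ⇒< a e ∘ Equivalence.from T-≡)

+-≡ᵇ : ∀ i k e → (i ℕ.+ k ≡ᵇ i ℕ.+ e) ≡ (k ≡ᵇ e)
+-≡ᵇ zero    k e = refl
+-≡ᵇ (suc i) k e = +-≡ᵇ i k e

[L∸e]+[M∸k]≡[L+M]∸[e+k] : ∀ L M {e k} → e ≤ L → k ≤ M → (L ∸ e) ℕ.+ (M ∸ k) ≡ (L ℕ.+ M) ∸ (e ℕ.+ k)
[L∸e]+[M∸k]≡[L+M]∸[e+k] L M {e} {k} e≤L k≤M = sym (begin
  (L ℕ.+ M) ∸ (e ℕ.+ k)   ≡⟨ sym (ℕ.∸-+-assoc (L ℕ.+ M) e k) ⟩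
  (L ℕ.+ M) ∸ e ∸ k       ≡⟨ cong (_∸ k) (ℕ.+-∸-comm M e≤L) ⟩
  (L ∸ e ℕ.+ M) ∸ k       ≡⟨ ℕ.+-∸-assoc (L ∸ e) k≤M ⟩
  (L ∸ e) ℕ.+ (M ∸ k)     ∎)
  where open ≡-Reasoning

Fin-injective⇒surjective : ∀ {m} (f : Fin m → Fin m) → Injective _≡_ _≡_ f → StrictlySurjective _≡_ f
Fin-injective⇒surjective f f-injective y with any? (λ x → f x Fin.≟ y)
... | yes hit = hit
Fin-injective⇒surjective {suc m} f f-injective y | no miss =
  contradiction (injective⇒≤ punchOut∘f-injective) ℕ.1+n≰n
  where
  y≢f : ∀ x → y ≢ f x
  y≢f x y≡fx = miss (x , sym y≡fx)
  punchOut∘f-injective : Injective _≡_ _≡_ (λ x → punchOut (y≢f x))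
  punchOut∘f-injective eq = f-injective (punchOut-injective (y≢f _) (y≢f _) eq)

module _ {A : Set} {m : ℕ} (Fin↔A : Fin m ↔ A) where
  open Inverse Fin↔A

  private
    from-injective : Injective _≡_ _≡_ from
    from-injective {x} {y} eq = trans (sym (strictlyInverseˡ x)) (trans (cong to eq) (strictlyInverseˡ y))

    to-injective : Injective _≡_ _≡_ to
    to-injective {i} {j} eq = trans (sym (strictlyInverseʳ i)) (trans (cong from eq) (strictlyInverseʳ j))

  injective⇒surjective : (f : A → A) → Injective _≡_ _≡_ f → StrictlySurjective _≡_ f
  injective⇒surjective f f-injective y =
    let i , hit = Fin-injective⇒surjective (from ∘ f ∘ to)
                    (λ eq → to-injective (f-injective (from-injective eq))) (from y)
    in to i , from-injective hit

  -- A section s of f is injective, hence surjective, and then s ∘ f = id.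
  surjective⇒injective : (f : A → A) → StrictlySurjective _≡_ f → Injective _≡_ _≡_ f
  surjective⇒injective f f-surjective {x} {x′} fx≡fx′ =
    trans (sym (s∘f x)) (trans (cong s fx≡fx′) (s∘f x′))
    where
    s : A → A
    s y = proj₁ (f-surjective y)
    f∘s : ∀ y → f (s y) ≡ y
    f∘s y = proj₂ (f-surjective y)
    s-injective : Injective _≡_ _≡_ s
    s-injective {y} {y′} sy≡sy′ = trans (sym (f∘s y)) (trans (cong f sy≡sy′) (f∘s y′))
    s∘f : ∀ x → s (f x) ≡ x
    s∘f x = let y , sy≡x = injective⇒surjective s s-injective x
            in trans (cong (s ∘ f) (sym sy≡x)) (trans (cong s (f∘s y)) sy≡x)

Fin-suc↔Maybe : ∀ {A : Set} {m} → Fin m ↔ A → Fin (suc m) ↔ Maybe A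
Fin-suc↔Maybe {A} {m} Fin↔A = mk↔ₛ′ to′ from′ to∘from from∘to
  where
  open Inverse Fin↔A
  to′ : Fin (suc m) → Maybe A
  to′ zero    = nothing
  to′ (suc i) = just (to i)
  from′ : Maybe A → Fin (suc m)
  from′ nothing  = zero
  from′ (just a) = suc (from a)
  to∘from : ∀ a → to′ (from′ a) ≡ a
  to∘from nothing  = refl
  to∘from (just a) = cong just (strictlyInverseˡ a)
  from∘to : ∀ i → from′ (to′ i) ≡ i
  from∘to zero    = refl
  from∘to (suc i) = cong suc (strictlyInverseʳ i)

module CommutativeRingRearrangements {c ℓ} (R : CommutativeRing c ℓ) where
  private
    ring : AlmostCommutativeRing c ℓ
    ring = fromCommutativeRing R (λ _ → nothing)
  open AlmostCommutativeRing ring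

  [ab][cd]≈[ad][bc] : ∀ a b c d → (a * b) * (c * d) ≈ (a * d) * (b * c)
  [ab][cd]≈[ad][bc] = solve-∀ ring

  [ab][cd]≈[ac][bd] : ∀ a b c d → (a * b) * (c * d) ≈ (a * c) * (b * d)
  [ab][cd]≈[ac][bd] = solve-∀ ring

  +-interchange : ∀ a b c d → (a + b) + (c + d) ≈ (a + c) + (b + d)
  +-interchange = solve-∀ ring

  a[bc]≈b[ac] : ∀ a b c → a * (b * c) ≈ b * (a * c)
  a[bc]≈b[ac] = solve-∀ ring

module FieldProperties (𝔽 : FiniteField) where
  open FiniteField 𝔽
  open FieldTheory 𝔽
  open IsCommutativeRing isCommutativeRing public
    using (+-assoc; *-assoc; *-comm; +-identityˡ; +-identityʳ; *-identityˡ; *-identityʳ;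
           zeroˡ; zeroʳ; distribˡ; distribʳ; -‿inverseʳ)

  commutativeRing : CommutativeRing 0ℓ 0ℓ
  commutativeRing = record { isCommutativeRing = isCommutativeRing }

  open CommutativeRing commutativeRing using (semiring; commutativeSemiring; *-commutativeMonoid)
  open CommutativeRingRearrangements commutativeRing public

  ⁻¹-inverseˡ : ∀ {x} → x ≢ 0# → x ⁻¹ * x ≡ 1#
  ⁻¹-inverseˡ {x} x≢0 = trans (*-comm _ _) (inverseʳ x x≢0)

  *-cancelˡ : ∀ {a x y} → a ≢ 0# → a * x ≡ a * y → x ≡ y
  *-cancelˡ {a} {x} {y} a≢0 ax≡ay = begin
    x                 ≡⟨ sym (*-identityˡ x) ⟩
    1# * x            ≡⟨ cong (_* x) (sym (⁻¹-inverseˡ a≢0)) ⟩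
    (a ⁻¹ * a) * x    ≡⟨ *-assoc _ _ _ ⟩
    a ⁻¹ * (a * x)    ≡⟨ cong (a ⁻¹ *_) ax≡ay ⟩
    a ⁻¹ * (a * y)    ≡⟨ sym (*-assoc _ _ _) ⟩
    (a ⁻¹ * a) * y    ≡⟨ cong (_* y) (⁻¹-inverseˡ a≢0) ⟩
    1# * y            ≡⟨ *-identityˡ y ⟩
    y                 ∎
    where open ≡-Reasoning

  [a+tb]+[-t]b≡a : ∀ a t b → (a + t * b) + (- t) * b ≡ a
  [a+tb]+[-t]b≡a a t b = begin
    (a + t * b) + (- t) * b    ≡⟨ +-assoc a _ _ ⟩
    a + (t * b + (- t) * b)    ≡⟨ cong (a +_) (sym (distribʳ b t (- t))) ⟩
    a + (t + - t) * b          ≡⟨ cong (λ s → a + s * b) (-‿inverseʳ t) ⟩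
    a + 0# * b                 ≡⟨ cong (a +_) (zeroˡ b) ⟩
    a + 0#                     ≡⟨ +-identityʳ a ⟩
    a                          ∎
    where open ≡-Reasoning

  *-cancelʳ : ∀ {a x y} → a ≢ 0# → x * a ≡ y * a → x ≡ y
  *-cancelʳ {a} {x} {y} a≢0 xa≡ya = *-cancelˡ a≢0 (trans (*-comm a x) (trans xa≡ya (*-comm y a)))

  x*y≢0 : ∀ {x y} → x ≢ 0# → y ≢ 0# → x * y ≢ 0#
  x*y≢0 {x} x≢0 y≢0 xy≡0 = y≢0 (*-cancelˡ x≢0 (trans xy≡0 (sym (zeroʳ x))))

  x*[x⁻¹*y]≡y : ∀ {x} y → x ≢ 0# → x * (x ⁻¹ * y) ≡ y
  x*[x⁻¹*y]≡y {x} y x≢0 = trans (sym (*-assoc _ _ _)) (trans (cong (_* y) (inverseʳ x x≢0)) (*-identityˡ y))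

  ⁻¹-unique : ∀ {x y} → x * y ≡ 1# → x ⁻¹ ≡ y
  ⁻¹-unique {x} {y} xy≡1 = *-cancelˡ x≢0 (trans (inverseʳ x x≢0) (sym xy≡1))
    where
    x≢0 : x ≢ 0#
    x≢0 x≡0 = 0≢1 (trans (sym (zeroˡ y)) (trans (cong (_* y) (sym x≡0)) xy≡1))

  *⁻¹-cross : ∀ {p q p′ q′} → q ≢ 0# → q′ ≢ 0# → p * q′ ≡ p′ * q → p * q ⁻¹ ≡ p′ * q′ ⁻¹
  *⁻¹-cross {p} {q} {p′} {q′} q≢0 q′≢0 cross = begin
    p * q ⁻¹                        ≡⟨ sym (*-identityʳ _) ⟩
    (p * q ⁻¹) * 1#                 ≡⟨ cong ((p * q ⁻¹) *_) (sym (inverseʳ q′ q′≢0)) ⟩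
    (p * q ⁻¹) * (q′ * q′ ⁻¹)       ≡⟨ [ab][cd]≈[ac][bd] p (q ⁻¹) q′ (q′ ⁻¹) ⟩
    (p * q′) * (q ⁻¹ * q′ ⁻¹)       ≡⟨ cong (_* (q ⁻¹ * q′ ⁻¹)) cross ⟩
    (p′ * q) * (q ⁻¹ * q′ ⁻¹)       ≡⟨ [ab][cd]≈[ad][bc] p′ q (q ⁻¹) (q′ ⁻¹) ⟩
    (p′ * q′ ⁻¹) * (q * q ⁻¹)       ≡⟨ cong ((p′ * q′ ⁻¹) *_) (inverseʳ q q≢0) ⟩
    (p′ * q′ ⁻¹) * 1#               ≡⟨ *-identityʳ _ ⟩
    p′ * q′ ⁻¹                      ∎
    where open ≡-Reasoning

  private
    module Exp = SemiringExp semiring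
    module CExp = CommutativeSemiringExp commutativeSemiring

  ^≗Exp^ : ∀ x k → x ^ k ≡ x Exp.^ k
  ^≗Exp^ x zero    = refl
  ^≗Exp^ x (suc k) = cong (x *_) (^≗Exp^ x k)

  ^-+ : ∀ x m k → x ^ (m ℕ.+ k) ≡ x ^ m * x ^ k
  ^-+ x m k = begin
    x ^ (m ℕ.+ k)             ≡⟨ ^≗Exp^ x (m ℕ.+ k) ⟩
    x Exp.^ (m ℕ.+ k)         ≡⟨ Exp.^-homo-* x m k ⟩
    x Exp.^ m * x Exp.^ k     ≡⟨ sym (cong₂ _*_ (^≗Exp^ x m) (^≗Exp^ x k)) ⟩
    x ^ m * x ^ k             ∎
    where open ≡-Reasoning

  ^-* : ∀ x m k → (x ^ k) ^ m ≡ x ^ (k ℕ.* m)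
  ^-* x m k = begin
    (x ^ k) ^ m               ≡⟨ ^≗Exp^ (x ^ k) m ⟩
    (x ^ k) Exp.^ m           ≡⟨ cong (Exp._^ m) (^≗Exp^ x k) ⟩
    (x Exp.^ k) Exp.^ m       ≡⟨ Exp.^-assocʳ x k m ⟩
    x Exp.^ (k ℕ.* m)         ≡⟨ sym (^≗Exp^ x (k ℕ.* m)) ⟩
    x ^ (k ℕ.* m)             ∎
    where open ≡-Reasoning

  ^-distrib-* : ∀ x y k → (x * y) ^ k ≡ x ^ k * y ^ k
  ^-distrib-* x y k = begin
    (x * y) ^ k               ≡⟨ ^≗Exp^ (x * y) k ⟩
    (x * y) Exp.^ k           ≡⟨ CExp.^-distrib-* x y k ⟩
    x Exp.^ k * y Exp.^ k     ≡⟨ sym (cong₂ _*_ (^≗Exp^ x k) (^≗Exp^ y k)) ⟩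
    x ^ k * y ^ k             ∎
    where open ≡-Reasoning

  1^ : ∀ k → 1# ^ k ≡ 1#
  1^ zero    = refl
  1^ (suc k) = trans (*-identityˡ _) (1^ k)

  ^≢0 : ∀ {x} k → x ≢ 0# → x ^ k ≢ 0#
  ^≢0 zero    x≢0 = 0≢1 ∘ sym
  ^≢0 (suc k) x≢0 = x*y≢0 x≢0 (^≢0 k x≢0)

  private
    module ∏ = CommutativeMonoidSum *-commutativeMonoid

  ∏-const : ∀ m z → ∏.sum {m} (λ _ → z) ≡ z ^ m
  ∏-const m z = trans (∏.sum-replicate m) (sym (^≗Exp^ z m))

  -- Multiplication by z permutes F; the product of the values `unit a` (a, or 1 for
  -- a = 0) is therefore unchanged by it, yet it also acquires a factor z for each a ≠ 0.
  fermat : ∀ {m} → Fin m ↔ F → ∀ {z} → z ≢ 0# → z ^ (m ∸ 1) ≡ 1#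
  fermat {zero}  Fin↔F = ⊥-elim (¬Fin0 (Inverse.from Fin↔F 0#))
  fermat {suc c} Fin↔F {z} z≢0 = sym (*-cancelʳ ∏unit≢0 (begin
    1# * ∏unit                                 ≡⟨ *-identityˡ _ ⟩
    ∏unit                                      ≡⟨ ∏.sum-permute (unit ∘ to) scaling ⟩
    ∏.sum (λ i → unit (to (from (z * to i))))
      ≡⟨ ∏.sum-cong-≗ (λ i → trans (cong unit (strictlyInverseˡ _)) (unit-scale (to i))) ⟩
    ∏.sum (λ i → factor (to i) * unit (to i))  ≡⟨ ∏.∑-distrib-+ (factor ∘ to) (unit ∘ to) ⟩
    ∏.sum (factor ∘ to) * ∏unit                ≡⟨ cong (_* ∏unit) ∏factor ⟩
    z ^ c * ∏unit                              ∎))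
    where
    open ≡-Reasoning
    open Inverse Fin↔F
    unit : F → F
    unit a with a ≟ 0#
    ... | yes _ = 1#
    ... | no  _ = a
    factor : F → F
    factor a with a ≟ 0#
    ... | yes _ = 1#
    ... | no  _ = z
    unit≢0 : ∀ a → unit a ≢ 0#
    unit≢0 a with a ≟ 0#
    ... | yes _   = 0≢1 ∘ sym
    ... | no  a≢0 = a≢0
    unit-scale : ∀ a → unit (z * a) ≡ factor a * unit a
    unit-scale a with a ≟ 0# | (z * a) ≟ 0#
    ... | yes _   | yes _    = sym (*-identityˡ _)
    ... | yes a≡0 | no za≢0  = ⊥-elim (za≢0 (trans (cong (z *_) a≡0) (zeroʳ z)))
    ... | no  a≢0 | yes za≡0 = ⊥-elim (x*y≢0 z≢0 a≢0 za≡0)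
    ... | no  _   | no  _    = refl
    ∏unit : F
    ∏unit = ∏.sum (unit ∘ to)
    ∏unit≢0 : ∏unit ≢ 0#
    ∏unit≢0 = ∏≢0 (unit≢0 ∘ to)
      where
      ∏≢0 : ∀ {k} {g : Fin k → F} → (∀ i → g i ≢ 0#) → ∏.sum g ≢ 0#
      ∏≢0 {zero}  _    = 0≢1 ∘ sym
      ∏≢0 {suc k} g≢0 = x*y≢0 (g≢0 zero) (∏≢0 (g≢0 ∘ suc))
    scaling : Permutation (suc c) (suc c)
    scaling = Perm.permutation (λ i → from (z * to i)) (λ i → from (z ⁻¹ * to i))
      (λ i → trans (cong (λ a → from (z * a)) (strictlyInverseˡ _))
                   (trans (cong from (x*[x⁻¹*y]≡y (to i) z≢0)) (strictlyInverseʳ i)))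
      (λ i → trans (cong (λ a → from (z ⁻¹ * a)) (strictlyInverseˡ _))
                   (trans (cong from (trans (sym (*-assoc _ _ _)) (trans (cong (_* to i) (⁻¹-inverseˡ z≢0)) (*-identityˡ _))))
                          (strictlyInverseʳ i)))
    ∏factor : ∏.sum (factor ∘ to) ≡ z ^ c
    ∏factor = begin
      ∏.sum (factor ∘ to)                                     ≡⟨ ∏.sum-remove {i = from 0#} (factor ∘ to) ⟩
      factor (to (from 0#)) * ∏.sum (removeAt (factor ∘ to) (from 0#))
        ≡⟨ cong₂ _*_ factor-at-0 (∏.sum-cong-≗ factor-elsewhere) ⟩
      1# * ∏.sum {c} (λ _ → z)                                ≡⟨ trans (*-identityˡ _) (∏-const c z) ⟩
      z ^ c                                                   ∎
      where
      factor-at-0 : factor (to (from 0#)) ≡ 1#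
      factor-at-0 rewrite strictlyInverseˡ 0# with 0# ≟ 0#
      ... | yes _ = refl
      ... | no 0≢0 = ⊥-elim (0≢0 refl)
      factor-elsewhere : ∀ j → factor (to (punchIn (from 0#) j)) ≡ z
      factor-elsewhere j with to (punchIn (from 0#) j) ≟ 0#
      ... | yes a≡0 = ⊥-elim (punchInᵢ≢i (from 0#) j (trans (sym (strictlyInverseʳ _)) (cong from a≡0)))
      ... | no  _   = refl

  ^≡1⇒^[k*e]≡1 : ∀ {z e} → z ^ e ≡ 1# → ∀ k → z ^ (k ℕ.* e) ≡ 1#
  ^≡1⇒^[k*e]≡1 {z} {e} zᵉ≡1 k =
    trans (cong (z ^_) (ℕ.*-comm k e)) (trans (sym (^-* z k e)) (trans (cong (_^ k) zᵉ≡1) (1^ k)))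

  ^≡1⇒≡^[1+k*e] : ∀ {z e} → z ^ e ≡ 1# → ∀ k → z ≡ z ^ (1 ℕ.+ k ℕ.* e)
  ^≡1⇒≡^[1+k*e] {z} {e} zᵉ≡1 k = sym (begin
    z ^ (1 ℕ.+ k ℕ.* e)      ≡⟨ ^-+ z 1 (k ℕ.* e) ⟩
    z ^ 1 * z ^ (k ℕ.* e)    ≡⟨ cong₂ _*_ (*-identityʳ z) (^≡1⇒^[k*e]≡1 zᵉ≡1 k) ⟩
    z * 1#                   ≡⟨ *-identityʳ z ⟩
    z                        ∎)
    where open ≡-Reasoning

  -- Bézout: 1 = a n - b (q - 1) or 1 = b (q - 1) - a n, and z ^ n = z ^ (q - 1) = 1.
  ^≡1⇒≡1 : ∀ {n z} → gcd n (q ∸ 1) ≡ 1 → z ≢ 0# → z ^ n ≡ 1# → z ≡ 1#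
  ^≡1⇒≡1 {n} {z} coprime z≢0 zⁿ≡1 =
    byBézout (Bézout.identity (subst (GCD n (q ∸ 1)) coprime (gcd-GCD n (q ∸ 1))))
    where
    z^[q-1]≡1 : z ^ (q ∸ 1) ≡ 1#
    z^[q-1]≡1 = fermat enum z≢0
    byBézout : Bézout.Identity 1 n (q ∸ 1) → z ≡ 1#
    byBézout (Bézout.+- a b 1+b*[q-1]≡a*n) =
      trans (^≡1⇒≡^[1+k*e] z^[q-1]≡1 b) (trans (cong (z ^_) 1+b*[q-1]≡a*n) (^≡1⇒^[k*e]≡1 zⁿ≡1 a))
    byBézout (Bézout.-+ a b 1+a*n≡b*[q-1]) =
      trans (^≡1⇒≡^[1+k*e] zⁿ≡1 a) (trans (cong (z ^_) 1+a*n≡b*[q-1]) (^≡1⇒^[k*e]≡1 z^[q-1]≡1 b))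

  ^-injective : ∀ {n x y} → gcd n (q ∸ 1) ≡ 1 → 1 ≤ n → x ^ n ≡ y ^ n → x ≡ y
  ^-injective {suc n} {x} {y} coprime _ xⁿ≡yⁿ with x ≟ 0# | y ≟ 0#
  ... | yes x≡0 | yes y≡0 = trans x≡0 (sym y≡0)
  ... | yes x≡0 | no  y≢0 = ⊥-elim (^≢0 (suc n) y≢0 (trans (sym xⁿ≡yⁿ) (trans (cong (_^ suc n) x≡0) (zeroˡ _))))
  ... | no  x≢0 | yes y≡0 = ⊥-elim (^≢0 (suc n) x≢0 (trans xⁿ≡yⁿ (trans (cong (_^ suc n) y≡0) (zeroˡ _))))
  ... | no  x≢0 | no  y≢0 = begin
    x                  ≡⟨ sym (*-identityʳ x) ⟩
    x * 1#             ≡⟨ cong (x *_) (sym (⁻¹-inverseˡ y≢0)) ⟩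
    x * (y ⁻¹ * y)     ≡⟨ sym (*-assoc _ _ _) ⟩
    (x * y ⁻¹) * y     ≡⟨ cong (_* y) (^≡1⇒≡1 {suc n} coprime (x*y≢0 x≢0 y⁻¹≢0) [x/y]ⁿ≡1) ⟩
    1# * y             ≡⟨ *-identityˡ y ⟩
    y                  ∎
    where
    open ≡-Reasoning
    y⁻¹≢0 : y ⁻¹ ≢ 0#
    y⁻¹≢0 y⁻¹≡0 = 0≢1 (trans (sym (zeroˡ y)) (trans (cong (_* y) (sym y⁻¹≡0)) (⁻¹-inverseˡ y≢0)))
    [x/y]ⁿ≡1 : (x * y ⁻¹) ^ suc n ≡ 1#
    [x/y]ⁿ≡1 = begin
      (x * y ⁻¹) ^ suc n           ≡⟨ ^-distrib-* x (y ⁻¹) (suc n) ⟩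
      x ^ suc n * (y ⁻¹) ^ suc n     ≡⟨ cong (_* (y ⁻¹) ^ suc n) xⁿ≡yⁿ ⟩
      y ^ suc n * (y ⁻¹) ^ suc n     ≡⟨ sym (^-distrib-* y (y ⁻¹) (suc n)) ⟩
      (y * y ⁻¹) ^ suc n           ≡⟨ cong (_^ suc n) (inverseʳ y y≢0) ⟩
      1# ^ suc n                   ≡⟨ 1^ (suc n) ⟩
      1#                           ∎

  -- u / v as a point of P¹ = F ∪ {∞}, with ∞ = nothing; also ratio 0 0 = ∞.
  ratio : F → F → Maybe F
  ratio u v with v ≟ 0#
  ... | yes _ = nothing
  ... | no  _ = just (u * v ⁻¹)

  ratio-∞ : ∀ {u v} → v ≡ 0# → ratio u v ≡ nothing
  ratio-∞ {v = v} v≡0 with v ≟ 0#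
  ... | yes _   = refl
  ... | no  v≢0 = ⊥-elim (v≢0 v≡0)

  ratio-finite : ∀ {u v} → v ≢ 0# → ratio u v ≡ just (u * v ⁻¹)
  ratio-finite {v = v} v≢0 with v ≟ 0#
  ... | yes v≡0 = ⊥-elim (v≢0 v≡0)
  ... | no  _   = refl

  ratio-/1 : ∀ u → ratio u 1# ≡ just u
  ratio-/1 u = trans (ratio-finite (0≢1 ∘ sym)) (cong just (trans (cong (u *_) (⁻¹-unique (*-identityˡ 1#))) (*-identityʳ u)))

  ratio-scale : ∀ {a u v} → a ≢ 0# → ratio (a * u) (a * v) ≡ ratio u v
  ratio-scale {a} {u} {v} a≢0 with v ≟ 0#
  ... | yes v≡0 = ratio-∞ (trans (cong (a *_) v≡0) (zeroʳ a))
  ... | no  v≢0 = trans (ratio-finite (x*y≢0 a≢0 v≢0)) (cong just (*⁻¹-cross (x*y≢0 a≢0 v≢0) v≢0 au*v≡u*av))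
    where
    au*v≡u*av : (a * u) * v ≡ u * (a * v)
    au*v≡u*av = trans (*-assoc a u v) (trans (cong (a *_) (*-comm u v)) (trans (sym (*-assoc a v u)) (*-comm (a * v) u)))

  ratio-cross : ∀ {u v u′ v′} → ¬ (u ≡ 0# × v ≡ 0#) → ¬ (u′ ≡ 0# × v′ ≡ 0#) →
                u * v′ ≡ u′ * v → ratio u v ≡ ratio u′ v′
  ratio-cross {u} {v} {u′} {v′} uv≢0 u′v′≢0 cross with v ≟ 0# | v′ ≟ 0#
  ... | yes _   | yes _    = refl
  ... | yes v≡0 | no  v′≢0 = ⊥-elim (uv≢0 (u≡0 , v≡0))
    where
    u≡0 : u ≡ 0#
    u≡0 = *-cancelʳ v′≢0 (trans cross (trans (cong (u′ *_) v≡0) (trans (zeroʳ u′) (sym (zeroˡ v′)))))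
  ... | no  v≢0 | yes v′≡0 = ⊥-elim (u′v′≢0 (u′≡0 , v′≡0))
    where
    u′≡0 : u′ ≡ 0#
    u′≡0 = *-cancelʳ v≢0 (trans (sym cross) (trans (cong (u *_) v′≡0) (trans (zeroʳ u) (sym (zeroˡ v)))))
  ... | no  v≢0 | no  v′≢0 = cong just (*⁻¹-cross v≢0 v′≢0 cross)

module Univariate (𝔽 : FiniteField) where
  open FiniteField 𝔽
  open FieldTheory 𝔽
  open FieldProperties 𝔽

  infix 4 _≈U_
  _≈U_ : UPoly → UPoly → Set
  p ≈U r = ∀ e → coeffU p e ≡ coeffU r e

  ∑ : ℕ → (ℕ → F) → F
  ∑ zero    f = 0#
  ∑ (suc m) f = f 0 + ∑ m (f ∘ suc)

  ∑-cong : ∀ m {f g : ℕ → F} → (∀ i → f i ≡ g i) → ∑ m f ≡ ∑ m g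
  ∑-cong zero    f≗g = refl
  ∑-cong (suc m) f≗g = cong₂ _+_ (f≗g 0) (∑-cong m (f≗g ∘ suc))

  ∑-zero : ∀ m {f : ℕ → F} → (∀ i → f i ≡ 0#) → ∑ m f ≡ 0#
  ∑-zero zero    f≗0 = refl
  ∑-zero (suc m) f≗0 = trans (cong₂ _+_ (f≗0 0) (∑-zero m (f≗0 ∘ suc))) (+-identityˡ _)

  ∑-+ : ∀ m (f g : ℕ → F) → ∑ m (λ i → f i + g i) ≡ ∑ m f + ∑ m g
  ∑-+ zero    f g = sym (+-identityˡ _)
  ∑-+ (suc m) f g = trans (cong (f 0 + g 0 +_) (∑-+ m (f ∘ suc) (g ∘ suc))) (+-interchange _ _ _ _)

  *-distribˡ-∑ : ∀ m c (f : ℕ → F) → c * ∑ m f ≡ ∑ m (λ i → c * f i)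
  *-distribˡ-∑ zero    c f = zeroʳ c
  *-distribˡ-∑ (suc m) c f = trans (distribˡ c _ _) (cong (c * f 0 +_) (*-distribˡ-∑ m c (f ∘ suc)))

  ∑-point : ∀ m {a} {f : ℕ → F} → a < m → (∀ i → i ≢ a → f i ≡ 0#) → ∑ m f ≡ f a
  ∑-point (suc m) {zero}  {f} _         f≗0 =
    trans (cong (f 0 +_) (∑-zero m (λ i → f≗0 (suc i) λ ()))) (+-identityʳ _)
  ∑-point (suc m) {suc a} {f} (s≤s a<m) f≗0 =
    trans (cong₂ _+_ (f≗0 0 λ ()) (∑-point m a<m (λ i i≢a → f≗0 (suc i) (i≢a ∘ ℕ.suc-injective)))) (+-identityˡ _)

  -- A bound on the exponents of the listed terms; it may exceed the degree, as terms can cancel.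
  ExpsBelow : ℕ → UPoly → Set
  ExpsBelow B = All (λ term → proj₂ term < B)

  ExpsBelow-mono : ∀ {B B′ p} → B ≤ B′ → ExpsBelow B p → ExpsBelow B′ p
  ExpsBelow-mono B≤B′ = All.map (λ a<B → ℕ.≤-trans a<B B≤B′)

  expBound : UPoly → ℕ
  expBound []            = 0
  expBound ((_ , a) ∷ p) = suc a ⊔ expBound p

  expsBelow-expBound : ∀ p → ExpsBelow (expBound p) p
  expsBelow-expBound []            = []
  expsBelow-expBound ((_ , a) ∷ p) =
    ℕ.m≤m⊔n (suc a) (expBound p) ∷ ExpsBelow-mono (ℕ.m≤n⊔m (suc a) (expBound p)) (expsBelow-expBound p)

  expsBelow-⊔ˡ : ∀ p B → ExpsBelow (expBound p ⊔ B) p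
  expsBelow-⊔ˡ p B = ExpsBelow-mono (ℕ.m≤m⊔n (expBound p) B) (expsBelow-expBound p)

  expsBelow-⊔ʳ : ∀ B p → ExpsBelow (B ⊔ expBound p) p
  expsBelow-⊔ʳ B p = ExpsBelow-mono (ℕ.m≤n⊔m B (expBound p)) (expsBelow-expBound p)

  coeff-≡ : ∀ a c → (if a ≡ᵇ a then c else 0#) ≡ c
  coeff-≡ a c rewrite ≡ᵇ-refl a = refl

  coeff-≢ : ∀ {a e} c → a ≢ e → (if a ≡ᵇ e then c else 0#) ≡ 0#
  coeff-≢ c a≢e rewrite ≢⇒≡ᵇ-false a≢e = refl

  coeffU-absent : ∀ p {e} → All (λ term → proj₂ term ≢ e) p → coeffU p e ≡ 0#
  coeffU-absent []            []            = refl
  coeffU-absent ((c , a) ∷ p) (a≢e ∷ p∌e) =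
    trans (cong₂ _+_ (coeff-≢ c a≢e) (coeffU-absent p p∌e)) (+-identityˡ _)

  coeffU-≥bound : ∀ {B} p {e} → ExpsBelow B p → B ≤ e → coeffU p e ≡ 0#
  coeffU-≥bound p p<B B≤e = coeffU-absent p (All.map (λ a<B a≡e → ℕ.<⇒≱ a<B (subst (_ ≤_) (sym a≡e) B≤e)) p<B)

  coeffU≢0⇒occurs : ∀ p {e} → coeffU p e ≢ 0# → Any (λ term → proj₂ term ≡ e) p
  coeffU≢0⇒occurs []            {e} pₑ≢0 = ⊥-elim (pₑ≢0 refl)
  coeffU≢0⇒occurs ((c , a) ∷ p) {e} pₑ≢0 with a ℕ.≟ e
  ... | yes a≡e = here a≡e
  ... | no  a≢e = there (coeffU≢0⇒occurs p (λ pₑ≡0 → pₑ≢0 (trans (cong₂ _+_ (coeff-≢ c a≢e) pₑ≡0) (+-identityˡ _))))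

  coeffU-++ : ∀ p r e → coeffU (p ++ r) e ≡ coeffU p e + coeffU r e
  coeffU-++ []            r e = sym (+-identityˡ _)
  coeffU-++ ((c , a) ∷ p) r e = trans (cong (_ +_) (coeffU-++ p r e)) (sym (+-assoc _ _ _))

  termSum : (ℕ → F) → UPoly → F
  termSum φ []            = 0#
  termSum φ ((c , a) ∷ p) = c * φ a + termSum φ p

  termSum≡∑ : ∀ {B} φ p → ExpsBelow B p → termSum φ p ≡ ∑ B (λ i → coeffU p i * φ i)
  termSum≡∑ {B} φ []            [] = sym (∑-zero B (λ i → zeroˡ (φ i)))
  termSum≡∑ {B} φ ((c , a) ∷ p) (a<B ∷ p<B) = begin
    c * φ a + termSum φ p
      ≡⟨ cong₂ _+_ (sym (trans (∑-point B a<B single-elsewhere) (cong (_* φ a) (coeff-≡ a c)))) (termSum≡∑ φ p p<B) ⟩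
    ∑ B single + ∑ B (λ i → coeffU p i * φ i)
      ≡⟨ sym (∑-+ B single (λ i → coeffU p i * φ i)) ⟩
    ∑ B (λ i → single i + coeffU p i * φ i)
      ≡⟨ ∑-cong B (λ i → sym (distribʳ (φ i) (if a ≡ᵇ i then c else 0#) (coeffU p i))) ⟩
    ∑ B (λ i → coeffU ((c , a) ∷ p) i * φ i)
      ∎
    where
    open ≡-Reasoning
    single : ℕ → F
    single i = (if a ≡ᵇ i then c else 0#) * φ i
    single-elsewhere : ∀ i → i ≢ a → single i ≡ 0#
    single-elsewhere i i≢a = trans (cong (_* φ i) (coeff-≢ c (i≢a ∘ sym))) (zeroˡ _)

  evalU≡termSum : ∀ p t → evalU p t ≡ termSum (t ^_) p
  evalU≡termSum []            t = refl
  evalU≡termSum ((c , a) ∷ p) t = cong (c * t ^ a +_) (evalU≡termSum p t)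

  evalU≡∑ : ∀ {B} p t → ExpsBelow B p → evalU p t ≡ ∑ B (λ i → coeffU p i * t ^ i)
  evalU≡∑ p t p<B = trans (evalU≡termSum p t) (termSum≡∑ (t ^_) p p<B)

  evalU-cong : ∀ {p r} → p ≈U r → ∀ t → evalU p t ≡ evalU r t
  evalU-cong {p} {r} p≈r t = begin
    evalU p t                          ≡⟨ evalU≡∑ p t (expsBelow-⊔ˡ p (expBound r)) ⟩
    ∑ B (λ i → coeffU p i * t ^ i)     ≡⟨ ∑-cong B (λ i → cong (_* t ^ i) (p≈r i)) ⟩
    ∑ B (λ i → coeffU r i * t ^ i)     ≡⟨ sym (evalU≡∑ r t (expsBelow-⊔ʳ (expBound p) r)) ⟩
    evalU r t                          ∎
    where
    open ≡-Reasoning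
    B : ℕ
    B = expBound p ⊔ expBound r

  shiftU : ℕ → UPoly → UPoly
  shiftU i = map (λ term → proj₁ term , i ℕ.+ proj₂ term)

  coeffU-shiftU-+ : ∀ h i e → coeffU (shiftU i h) (i ℕ.+ e) ≡ coeffU h e
  coeffU-shiftU-+ []            i e = refl
  coeffU-shiftU-+ ((d , k) ∷ h) i e =
    cong₂ _+_ (cong (if_then d else 0#) (+-≡ᵇ i k e)) (coeffU-shiftU-+ h i e)

  coeffU-shiftU-< : ∀ h {i e} → e < i → coeffU (shiftU i h) e ≡ 0#
  coeffU-shiftU-< h {i} e<i = coeffU-absent (shiftU i h) (shifted-exps h)
    where
    shifted-exps : ∀ h → All (λ term → proj₂ term ≢ _) (shiftU i h)
    shifted-exps []      = []
    shifted-exps (_ ∷ h) = (λ i+k≡e → ℕ.<⇒≱ e<i (subst (i ≤_) i+k≡e (ℕ.m≤m+n i _))) ∷ shifted-exps h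

  coeffU-shiftU-≥ : ∀ h {i e} → i ≤ e → coeffU (shiftU i h) e ≡ coeffU h (e ∸ i)
  coeffU-shiftU-≥ h {i} {e} i≤e =
    subst (λ x → coeffU (shiftU i h) x ≡ coeffU h (e ∸ i)) (ℕ.m+[n∸m]≡n i≤e) (coeffU-shiftU-+ h i (e ∸ i))

  shiftU-cong : ∀ {h h′} → h ≈U h′ → ∀ i → shiftU i h ≈U shiftU i h′
  shiftU-cong {h} {h′} h≈h′ i e with i ℕ.≤? e
  ... | yes i≤e = trans (coeffU-shiftU-≥ h i≤e) (trans (h≈h′ (e ∸ i)) (sym (coeffU-shiftU-≥ h′ i≤e)))
  ... | no  i≰e = trans (coeffU-shiftU-< h (ℕ.≰⇒> i≰e)) (sym (coeffU-shiftU-< h′ (ℕ.≰⇒> i≰e)))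

  -- In `mulU ((c , i) ∷ g) h` a pattern lambda of Defs is mapped over h; it can only be
  -- named by unification, so the next two lemmas take it as an argument L given by its action.
  coeffU-map-term : ∀ (L : F × ℕ → F × ℕ) c i → (∀ d k → L (d , k) ≡ (c * d , i ℕ.+ k)) →
                    ∀ h e → coeffU (map L h) e ≡ c * coeffU (shiftU i h) e
  coeffU-map-term L c i L-def []            e = sym (zeroʳ c)
  coeffU-map-term L c i L-def ((d , k) ∷ h) e rewrite L-def d k =
    trans (cong₂ _+_ (scaled-coeff (i ℕ.+ k ≡ᵇ e)) (coeffU-map-term L c i L-def h e)) (sym (distribˡ _ _ _))
    where
    scaled-coeff : ∀ b → (if b then c * d else 0#) ≡ c * (if b then d else 0#)
    scaled-coeff true  = refl
    scaled-coeff false = sym (zeroʳ c)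

  evalU-map-term : ∀ (L : F × ℕ → F × ℕ) c i → (∀ d k → L (d , k) ≡ (c * d , i ℕ.+ k)) →
                   ∀ h t → evalU (map L h) t ≡ (c * t ^ i) * evalU h t
  evalU-map-term L c i L-def []            t = sym (zeroʳ _)
  evalU-map-term L c i L-def ((d , k) ∷ h) t rewrite L-def d k =
    trans (cong₂ _+_ term (evalU-map-term L c i L-def h t)) (sym (distribˡ _ _ _))
    where
    term : (c * d) * t ^ (i ℕ.+ k) ≡ (c * t ^ i) * (d * t ^ k)
    term = trans (cong ((c * d) *_) (^-+ t i k)) ([ab][cd]≈[ac][bd] c d _ _)

  coeffU-mulU : ∀ g h e → coeffU (mulU g h) e ≡ termSum (λ i → coeffU (shiftU i h) e) g
  coeffU-mulU []            h e = refl
  coeffU-mulU ((c , i) ∷ g) h e =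
    trans (coeffU-++ (map _ h) (mulU g h) e)
          (cong₂ _+_ (coeffU-map-term _ c i (λ d k → refl) h e) (coeffU-mulU g h e))

  coeffU-mulU≡∑ : ∀ {B} g h e → ExpsBelow B g → coeffU (mulU g h) e ≡ ∑ B (λ i → coeffU g i * coeffU (shiftU i h) e)
  coeffU-mulU≡∑ g h e g<B = trans (coeffU-mulU g h e) (termSum≡∑ _ g g<B)

  mulU-cong : ∀ {g g′ h h′} → g ≈U g′ → h ≈U h′ → mulU g h ≈U mulU g′ h′
  mulU-cong {g} {g′} {h} {h′} g≈g′ h≈h′ e = begin
    coeffU (mulU g h) e
      ≡⟨ coeffU-mulU≡∑ g h e (expsBelow-⊔ˡ g (expBound g′)) ⟩
    ∑ B (λ i → coeffU g i * coeffU (shiftU i h) e)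
      ≡⟨ ∑-cong B (λ i → cong₂ _*_ (g≈g′ i) (shiftU-cong {h} {h′} h≈h′ i e)) ⟩
    ∑ B (λ i → coeffU g′ i * coeffU (shiftU i h′) e)
      ≡⟨ sym (coeffU-mulU≡∑ g′ h′ e (expsBelow-⊔ʳ (expBound g) g′)) ⟩
    coeffU (mulU g′ h′) e
      ∎
    where
    open ≡-Reasoning
    B : ℕ
    B = expBound g ⊔ expBound g′

  evalU-++ : ∀ p r t → evalU (p ++ r) t ≡ evalU p t + evalU r t
  evalU-++ []            r t = sym (+-identityˡ _)
  evalU-++ ((c , a) ∷ p) r t = trans (cong (c * t ^ a +_) (evalU-++ p r t)) (sym (+-assoc _ _ _))

  evalU-mulU : ∀ g h t → evalU (mulU g h) t ≡ evalU g t * evalU h t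
  evalU-mulU []            h t = sym (zeroˡ _)
  evalU-mulU ((c , i) ∷ g) h t =
    trans (evalU-++ (map _ h) (mulU g h) t)
          (trans (cong₂ _+_ (evalU-map-term _ c i (λ d k → refl) h t) (evalU-mulU g h t)) (sym (distribʳ _ _ _)))

  isZero-false : ∀ {x} → x ≢ 0# → isZero x ≡ false
  isZero-false {x} x≢0 with x ≟ 0#
  ... | yes x≡0 = ⊥-elim (x≢0 x≡0)
  ... | no  _   = refl

  -- `degU p` folds a pattern lambda of Defs over p which keeps consulting the
  -- coefficients of the whole of p, so the fold is studied for an arbitrary C.
  module DegreeFold (C : ℕ → F) (step : F × ℕ → ℕ → ℕ)
                    (step-def : ∀ c a acc → step (c , a) acc ≡ (if isZero (C a) then acc else a ⊔ acc)) where
    deg : UPoly → ℕ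
    deg = foldr step 0

    ≤-step : ∀ c a acc → acc ≤ step (c , a) acc
    ≤-step c a acc rewrite step-def c a acc with isZero (C a)
    ... | true  = ℕ.≤-refl
    ... | false = ℕ.m≤n⊔m a acc

    ≤-deg : ∀ l {e} → Any (λ term → proj₂ term ≡ e) l → C e ≢ 0# → e ≤ deg l
    ≤-deg ((c , a) ∷ l) (here refl) Cₐ≢0 rewrite step-def c a (deg l) | isZero-false Cₐ≢0 = ℕ.m≤m⊔n a (deg l)
    ≤-deg ((c , a) ∷ l) (there e∈l) Cₑ≢0 = ℕ.≤-trans (≤-deg l e∈l Cₑ≢0) (≤-step c a (deg l))

    deg≡0⊎C[deg]≢0 : ∀ l → (deg l ≡ 0 × All (λ term → C (proj₂ term) ≡ 0#) l) ⊎ C (deg l) ≢ 0#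
    deg≡0⊎C[deg]≢0 [] = inj₁ (refl , [])
    deg≡0⊎C[deg]≢0 ((c , a) ∷ l) rewrite step-def c a (deg l) with C a ≟ 0# | deg≡0⊎C[deg]≢0 l
    ... | yes Cₐ≡0 | inj₁ (deg≡0 , l-vanishes) = inj₁ (deg≡0 , Cₐ≡0 ∷ l-vanishes)
    ... | yes Cₐ≡0 | inj₂ C[deg]≢0            = inj₂ C[deg]≢0
    ... | no  Cₐ≢0 | inj₁ (deg≡0 , _) rewrite deg≡0 | ℕ.⊔-identityʳ a = inj₂ Cₐ≢0
    ... | no  Cₐ≢0 | inj₂ C[deg]≢0 with ℕ.⊔-sel a (deg l)
    ...   | inj₁ a⊔deg≡a   rewrite a⊔deg≡a   = inj₂ Cₐ≢0
    ...   | inj₂ a⊔deg≡deg rewrite a⊔deg≡deg = inj₂ C[deg]≢0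

  ≤-degU : ∀ p {e} → coeffU p e ≢ 0# → e ≤ degU p
  ≤-degU p pₑ≢0 = DegreeFold.≤-deg (coeffU p) _ (λ _ _ _ → refl) p (coeffU≢0⇒occurs p pₑ≢0) pₑ≢0

  ≈U[]⊎leadU≢0 : ∀ p → p ≈U [] ⊎ leadU p ≢ 0#
  ≈U[]⊎leadU≢0 p with DegreeFold.deg≡0⊎C[deg]≢0 (coeffU p) _ (λ _ _ _ → refl) p
  ... | inj₂ lead≢0             = inj₂ lead≢0
  ... | inj₁ (_ , p-vanishes)   = inj₁ vanishes
    where
    vanishes : p ≈U []
    vanishes e with coeffU p e ≟ 0#
    ... | yes pₑ≡0 = pₑ≡0
    ... | no  pₑ≢0 = ⊥-elim (pₑ≢0 (All.lookupWith (λ pₐ≡0 a≡e → subst (λ k → coeffU p k ≡ 0#) a≡e pₐ≡0)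
                                                   p-vanishes (coeffU≢0⇒occurs p pₑ≢0)))

  leadU≢0 : ∀ p → NonZeroU p → leadU p ≢ 0#
  leadU≢0 p (e , pₑ≢0) with ≈U[]⊎leadU≢0 p
  ... | inj₁ p≈0    = ⊥-elim (pₑ≢0 (p≈0 e))
  ... | inj₂ lead≢0 = lead≢0

  NonZeroU⊎≈U[] : ∀ p → NonZeroU p ⊎ p ≈U []
  NonZeroU⊎≈U[] p with ≈U[]⊎leadU≢0 p
  ... | inj₁ p≈0    = inj₂ p≈0
  ... | inj₂ lead≢0 = inj₁ (degU p , lead≢0)

  degU-≈U[] : ∀ p → p ≈U [] → degU p ≡ 0
  degU-≈U[] p p≈0 with DegreeFold.deg≡0⊎C[deg]≢0 (coeffU p) _ (λ _ _ _ → refl) p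
  ... | inj₁ (deg≡0 , _) = deg≡0
  ... | inj₂ lead≢0      = ⊥-elim (lead≢0 (p≈0 _))

  coeffU-above-degU : ∀ p {e} → degU p < e → coeffU p e ≡ 0#
  coeffU-above-degU p {e} deg<e with coeffU p e ≟ 0#
  ... | yes pₑ≡0 = pₑ≡0
  ... | no  pₑ≢0 = ⊥-elim (ℕ.<⇒≱ deg<e (≤-degU p pₑ≢0))

  degU-unique : ∀ p {d} → coeffU p d ≢ 0# → (∀ e → d < e → coeffU p e ≡ 0#) → degU p ≡ d
  degU-unique p {d} p_d≢0 above-vanishes = ℕ.≤-antisym degU≤d (≤-degU p p_d≢0)
    where
    degU≤d : degU p ≤ d
    degU≤d with degU p ℕ.≤? d
    ... | yes deg≤d = deg≤d
    ... | no  deg≰d = ⊥-elim (leadU≢0 p (d , p_d≢0) (above-vanishes _ (ℕ.≰⇒> deg≰d)))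

  degU-cong : ∀ p r → p ≈U r → degU p ≡ degU r
  degU-cong p r p≈r with NonZeroU⊎≈U[] p
  ... | inj₁ p≢0 = sym (degU-unique r (λ r≡0 → leadU≢0 p p≢0 (trans (p≈r _) r≡0))
                                      (λ e deg<e → trans (sym (p≈r e)) (coeffU-above-degU p deg<e)))
  ... | inj₂ p≈0 = trans (degU-≈U[] p p≈0) (sym (degU-≈U[] r (λ e → trans (sym (p≈r e)) (p≈0 e))))

  module _ (g h : UPoly) where
    private
      D : ℕ
      D = degU g
      E : ℕ
      E = degU h

    coeffU-mulU-term-vanishes : ∀ i e → D < i ⊎ (i ≤ e × E < e ∸ i) → coeffU g i * coeffU (shiftU i h) e ≡ 0#
    coeffU-mulU-term-vanishes i e (inj₁ D<i) =
      trans (cong (_* _) (coeffU-above-degU g D<i)) (zeroˡ _)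
    coeffU-mulU-term-vanishes i e (inj₂ (i≤e , E<e∸i)) =
      trans (cong (coeffU g i *_) (trans (coeffU-shiftU-≥ h i≤e) (coeffU-above-degU h E<e∸i))) (zeroʳ _)

    coeffU-mulU-top : coeffU (mulU g h) (D ℕ.+ E) ≡ leadU g * leadU h
    coeffU-mulU-top = begin
      coeffU (mulU g h) (D ℕ.+ E)                           ≡⟨ coeffU-mulU≡∑ g h _ (expsBelow-⊔ʳ (suc D) g) ⟩
      ∑ B (λ i → coeffU g i * coeffU (shiftU i h) (D ℕ.+ E)) ≡⟨ ∑-point B (ℕ.m≤m⊔n (suc D) (expBound g)) off-diagonal ⟩
      leadU g * coeffU (shiftU D h) (D ℕ.+ E)               ≡⟨ cong (leadU g *_) (coeffU-shiftU-+ h D E) ⟩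
      leadU g * leadU h                                     ∎
      where
      open ≡-Reasoning
      B : ℕ
      B = suc D ⊔ expBound g
      off-diagonal : ∀ i → i ≢ D → coeffU g i * coeffU (shiftU i h) (D ℕ.+ E) ≡ 0#
      off-diagonal i i≢D with ℕ.<-cmp i D
      ... | tri< i<D _ _ = coeffU-mulU-term-vanishes i _ (inj₂ (ℕ.≤-trans (ℕ.<⇒≤ i<D) (ℕ.m≤m+n D E) ,
              subst (_< (D ℕ.+ E) ∸ i) (ℕ.m+n∸m≡n D E) (ℕ.∸-monoʳ-< i<D (ℕ.m≤m+n D E))))
      ... | tri≈ _ i≡D _ = ⊥-elim (i≢D i≡D)
      ... | tri> _ _ D<i = coeffU-mulU-term-vanishes i _ (inj₁ D<i)

    coeffU-mulU-above : ∀ {e} → D ℕ.+ E < e → coeffU (mulU g h) e ≡ 0#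
    coeffU-mulU-above {e} D+E<e =
      trans (coeffU-mulU≡∑ g h e (expsBelow-expBound g)) (∑-zero (expBound g) vanishes)
      where
      vanishes : ∀ i → coeffU g i * coeffU (shiftU i h) e ≡ 0#
      vanishes i with D ℕ.<? i
      ... | yes D<i = coeffU-mulU-term-vanishes i e (inj₁ D<i)
      ... | no  D≮i = coeffU-mulU-term-vanishes i e (inj₂ (i≤e , E<e∸i))
        where
        i≤D : i ≤ D
        i≤D = ℕ.≮⇒≥ D≮i
        i≤e : i ≤ e
        i≤e = ℕ.≤-trans i≤D (ℕ.≤-trans (ℕ.m≤m+n D E) (ℕ.<⇒≤ D+E<e))
        E<e∸i : E < e ∸ i
        E<e∸i = ℕ.<-≤-trans (subst (_< e ∸ D) (ℕ.m+n∸m≡n D E) (ℕ.∸-monoˡ-< D+E<e (ℕ.m≤m+n D E)))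
                            (ℕ.∸-monoʳ-≤ e i≤D)

    mulU-NonZeroU : NonZeroU g → NonZeroU h → NonZeroU (mulU g h)
    mulU-NonZeroU g≢0 h≢0 =
      D ℕ.+ E , λ top≡0 → x*y≢0 (leadU≢0 g g≢0) (leadU≢0 h h≢0) (trans (sym coeffU-mulU-top) top≡0)

    degU-mulU : NonZeroU g → NonZeroU h → degU (mulU g h) ≡ D ℕ.+ E
    degU-mulU g≢0 h≢0 = degU-unique (mulU g h) (proj₂ (mulU-NonZeroU g≢0 h≢0)) (λ _ → coeffU-mulU-above)

  dense : (ℕ → F) → ℕ → UPoly
  dense f zero    = []
  dense f (suc m) = (f m , m) ∷ dense f m

  expsBelow-dense : ∀ f m → ExpsBelow m (dense f m)
  expsBelow-dense f zero    = []
  expsBelow-dense f (suc m) = ℕ.≤-refl ∷ ExpsBelow-mono (ℕ.n≤1+n m) (expsBelow-dense f m)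

  coeffU-dense-≥ : ∀ f m {e} → m ≤ e → coeffU (dense f m) e ≡ 0#
  coeffU-dense-≥ f m = coeffU-≥bound (dense f m) (expsBelow-dense f m)

  coeffU-dense-< : ∀ f m {e} → e < m → coeffU (dense f m) e ≡ f e
  coeffU-dense-< f (suc m) {e} e<1+m with m ℕ.≟ e
  ... | yes refl = trans (cong₂ _+_ (coeff-≡ m (f m)) (coeffU-dense-≥ f m ℕ.≤-refl)) (+-identityʳ _)
  ... | no  m≢e  = trans (cong₂ _+_ (coeff-≢ (f m) m≢e) (coeffU-dense-< f m (ℕ.≤∧≢⇒< (ℕ.s≤s⁻¹ e<1+m) (m≢e ∘ sym))))
                         (+-identityˡ _)

  dense-coeffU : ∀ p m → (∀ e → m ≤ e → coeffU p e ≡ 0#) → dense (coeffU p) m ≈U p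
  dense-coeffU p m p-vanishes e with e ℕ.<? m
  ... | yes e<m = coeffU-dense-< (coeffU p) m e<m
  ... | no  e≮m = trans (coeffU-dense-≥ (coeffU p) m (ℕ.≮⇒≥ e≮m)) (sym (p-vanishes e (ℕ.≮⇒≥ e≮m)))

  linearFactor : F → UPoly
  linearFactor t₀ = (1# , 1) ∷ (- t₀ , 0) ∷ []

  degU-linearFactor : ∀ t₀ → degU (linearFactor t₀) ≡ 1
  degU-linearFactor t₀ = degU-unique (linearFactor t₀) 1+[0+0]≢0 above-1
    where
    1+[0+0]≢0 : 1# + (0# + 0#) ≢ 0#
    1+[0+0]≢0 eq = 0≢1 (sym (trans (sym (trans (cong (1# +_) (+-identityʳ 0#)) (+-identityʳ 1#))) eq))
    above-1 : ∀ e → 1 < e → coeffU (linearFactor t₀) e ≡ 0#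
    above-1 (suc zero)    (s≤s ())
    above-1 (suc (suc e)) _ = trans (+-identityˡ _) (+-identityʳ _)

  -- Synthetic division: the quotient of A by t - t₀ has k-th coefficient
  -- ∑ⱼ a (1 + k + j) t₀ ^ j, and the remainder is A(t₀).
  module FactorTheorem (A : UPoly) (t₀ : F) (A[t₀]≡0 : evalU A t₀ ≡ 0#) where
    private
      B : ℕ
      B = expBound A
      a : ℕ → F
      a = coeffU A

      tail : ℕ → ℕ → F
      tail m k = ∑ m (λ j → a (k ℕ.+ j) * t₀ ^ j)

      tail-step : ∀ m k → (m ≡ 0 → a k ≡ 0#) → tail m k ≡ a k + t₀ * tail (ℕ.pred m) (suc k)
      tail-step zero    k aₖ≡0 = sym (trans (cong₂ _+_ (aₖ≡0 refl) (zeroʳ t₀)) (+-identityˡ _))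
      tail-step (suc m) k _    = cong₂ _+_
        (trans (*-identityʳ _) (cong a (ℕ.+-identityʳ k)))
        (trans (∑-cong m (λ j → trans (cong (_* _) (cong a (ℕ.+-suc k j))) (a[bc]≈b[ac] _ t₀ _)))
               (sym (*-distribˡ-∑ m t₀ _)))

    quotientCoeff : ℕ → F
    quotientCoeff k = tail (B ∸ suc k) (suc k)

    private
      tail-split : ∀ k → tail (B ∸ k) k ≡ a k + t₀ * quotientCoeff k
      tail-split k = trans
        (tail-step (B ∸ k) k (λ B∸k≡0 → coeffU-≥bound A (expsBelow-expBound A) (ℕ.m∸n≡0⇒m≤n B∸k≡0)))
        (cong (λ m → a k + t₀ * tail m (suc k)) (ℕ.pred[m∸n]≡m∸[1+n] B k))

      a₀+t₀q₀≡0 : a 0 + t₀ * quotientCoeff 0 ≡ 0#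
      a₀+t₀q₀≡0 = trans (sym (tail-split 0)) (trans (sym (evalU≡∑ A t₀ (expsBelow-expBound A))) A[t₀]≡0)

    quotient : UPoly
    quotient = dense quotientCoeff B

    coeffU-quotient : ∀ k → coeffU quotient k ≡ quotientCoeff k
    coeffU-quotient k with k ℕ.<? B
    ... | yes k<B = coeffU-dense-< quotientCoeff B k<B
    ... | no  k≮B = trans (coeffU-dense-≥ quotientCoeff B (ℕ.≮⇒≥ k≮B))
                          (cong (λ m → tail m (suc k)) (sym (ℕ.m≤n⇒m∸n≡0 (ℕ.≤-trans (ℕ.≮⇒≥ k≮B) (ℕ.n≤1+n k)))))

    linearFactor∣U : linearFactor t₀ ∣U A
    linearFactor∣U = quotient , λ e → sym (trans (coeffU-mulU (linearFactor t₀) quotient e) (coefficient e))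
      where
      open ≡-Reasoning
      h : ℕ → F
      h = quotientCoeff
      coefficient : ∀ e → 1# * coeffU (shiftU 1 quotient) e + ((- t₀) * coeffU (shiftU 0 quotient) e + 0#) ≡ a e
      coefficient zero = begin
        1# * coeffU (shiftU 1 quotient) 0 + ((- t₀) * coeffU (shiftU 0 quotient) 0 + 0#)
          ≡⟨ cong₂ (λ x y → 1# * x + ((- t₀) * y + 0#)) (coeffU-shiftU-< quotient (ℕ.s≤s ℕ.z≤n))
                                                        (trans (coeffU-shiftU-+ quotient 0 0) (coeffU-quotient 0)) ⟩
        1# * 0# + ((- t₀) * h 0 + 0#)     ≡⟨ cong₂ _+_ (zeroʳ 1#) (+-identityʳ _) ⟩
        0# + (- t₀) * h 0                 ≡⟨ cong (_+ (- t₀) * h 0) (sym a₀+t₀q₀≡0) ⟩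
        (a 0 + t₀ * h 0) + (- t₀) * h 0   ≡⟨ [a+tb]+[-t]b≡a (a 0) t₀ (h 0) ⟩
        a 0                               ∎
      coefficient (suc e) = begin
        1# * coeffU (shiftU 1 quotient) (suc e) + ((- t₀) * coeffU (shiftU 0 quotient) (suc e) + 0#)
          ≡⟨ cong₂ (λ x y → 1# * x + ((- t₀) * y + 0#)) (trans (coeffU-shiftU-+ quotient 1 e) (coeffU-quotient e))
                                                        (trans (coeffU-shiftU-+ quotient 0 (suc e)) (coeffU-quotient (suc e))) ⟩
        1# * h e + ((- t₀) * h (suc e) + 0#)             ≡⟨ cong₂ _+_ (*-identityˡ _) (+-identityʳ _) ⟩
        h e + (- t₀) * h (suc e)                         ≡⟨ cong (_+ (- t₀) * h (suc e)) (tail-split (suc e)) ⟩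
        (a (suc e) + t₀ * h (suc e)) + (- t₀) * h (suc e) ≡⟨ [a+tb]+[-t]b≡a _ t₀ _ ⟩
        a (suc e)                                        ∎

  CoprimeU⇒no-common-root : ∀ A A′ {t} → CoprimeU A A′ → evalU A t ≡ 0# → evalU A′ t ≡ 0# → ⊥
  CoprimeU⇒no-common-root A A′ {t} coprime A[t]≡0 A′[t]≡0
    with trans (sym (degU-linearFactor t))
               (coprime (linearFactor t) (FactorTheorem.linearFactor∣U A t A[t]≡0)
                                         (FactorTheorem.linearFactor∣U A′ t A′[t]≡0))
  ... | ()

  evalU-mulU-cross : ∀ P Q P′ Q′ → mulU P Q′ ≈U mulU P′ Q → ∀ t → evalU P t * evalU Q′ t ≡ evalU P′ t * evalU Q t
  evalU-mulU-cross P Q P′ Q′ PQ′≈P′Q t =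
    trans (sym (evalU-mulU P Q′ t)) (trans (evalU-cong {mulU P Q′} {mulU P′ Q} PQ′≈P′Q t) (evalU-mulU P′ Q t))

  degU-cross-< : ∀ P Q P′ Q′ → NonZeroU Q → NonZeroU Q′ → NonZeroU P′ → mulU P Q′ ≈U mulU P′ Q →
                 degU P < degU Q → degU P′ < degU Q′
  degU-cross-< P Q P′ Q′ Q≢0 Q′≢0 P′≢0 PQ′≈P′Q degP<degQ with NonZeroU⊎≈U[] P
  ... | inj₂ P≈0 = ⊥-elim (proj₂ (mulU-NonZeroU P′ Q P′≢0 Q≢0)
                      (trans (sym (PQ′≈P′Q _)) (mulU-cong {P} {[]} {Q′} {Q′} P≈0 (λ _ → refl) _)))
  ... | inj₁ P≢0 with degU P′ ℕ.<? degU Q′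
  ...   | yes deg< = deg<
  ...   | no  deg≮ = ⊥-elim (ℕ.<-irrefl degrees (ℕ.+-mono-<-≤ degP<degQ (ℕ.≮⇒≥ deg≮)))
    where
    degrees : degU P ℕ.+ degU Q′ ≡ degU Q ℕ.+ degU P′
    degrees = begin
      degU P ℕ.+ degU Q′       ≡⟨ sym (degU-mulU P Q′ P≢0 Q′≢0) ⟩
      degU (mulU P Q′)         ≡⟨ degU-cong (mulU P Q′) (mulU P′ Q) PQ′≈P′Q ⟩
      degU (mulU P′ Q)         ≡⟨ degU-mulU P′ Q P′≢0 Q≢0 ⟩
      degU P′ ℕ.+ degU Q       ≡⟨ ℕ.+-comm (degU P′) (degU Q) ⟩
      degU Q ℕ.+ degU P′       ∎
      where open ≡-Reasoning

  induced-just : ∀ P Q t → induced P Q (just t) ≡ ratio (evalU P t) (evalU Q t)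
  induced-just P Q t with evalU Q t ≟ 0#
  ... | yes _ = refl
  ... | no  _ = refl

  induced-∞ : ∀ P Q → degU P < degU Q → induced P Q nothing ≡ just 0#
  induced-∞ P Q degP<degQ rewrite ≮⇒<ᵇ-false (ℕ.<⇒≯ degP<degQ) | <⇒<ᵇ-true degP<degQ = refl

module Homogeneous (𝔽 : FiniteField) where
  open FiniteField 𝔽
  open FieldTheory 𝔽
  open FieldProperties 𝔽
  open Univariate 𝔽

  -- hom L g is the degree-L homogenisation x ^ L g (y / x) of g.
  hom : ℕ → UPoly → Poly2
  hom L = map (λ term → proj₁ term , L ∸ proj₂ term , proj₂ term)

  homPoly≡hom-dehom : ∀ n m (c : Fin m → F) → homPoly n m c ≡ hom n (dehom (homPoly n m c))
  homPoly≡hom-dehom n m c = go (allFin m)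
    where
    go : ∀ ks → map (λ k → c k , n ∸ toℕ k , toℕ k) ks ≡ hom n (dehom (map (λ k → c k , n ∸ toℕ k , toℕ k) ks))
    go []       = refl
    go (k ∷ ks) = cong (_ ∷_) (go ks)

  expsBelow-dehom-homPoly : ∀ n m (c : Fin m → F) → ExpsBelow m (dehom (homPoly n m c))
  expsBelow-dehom-homPoly n m c = go (allFin m)
    where
    go : ∀ ks → ExpsBelow m (dehom (map (λ k → c k , n ∸ toℕ k , toℕ k) ks))
    go []       = []
    go (k ∷ ks) = toℕ<n k ∷ go ks

  coeff2-hom-on : ∀ L g {i j} → ExpsBelow (suc L) g → i ℕ.+ j ≡ L → coeff2 (hom L g) i j ≡ coeffU g j
  coeff2-hom-on L []            []           i+j≡L = refl
  coeff2-hom-on L ((c , e) ∷ g) {i} {j} (e<1+L ∷ g<1+L) i+j≡L = cong₂ _+_ term (coeff2-hom-on L g g<1+L i+j≡L)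
    where
    term : (if (L ∸ e ≡ᵇ i) ∧ (e ≡ᵇ j) then c else 0#) ≡ (if e ≡ᵇ j then c else 0#)
    term with e ℕ.≟ j
    ... | yes refl rewrite ≡ᵇ-refl e | sym i+j≡L | ℕ.m+n∸n≡m i e | ≡ᵇ-refl i = refl
    ... | no  e≢j  rewrite ≢⇒≡ᵇ-false e≢j with L ∸ e ≡ᵇ i
    ...   | true  = refl
    ...   | false = refl

  coeff2-hom-off : ∀ L g {i j} → ExpsBelow (suc L) g → i ℕ.+ j ≢ L → coeff2 (hom L g) i j ≡ 0#
  coeff2-hom-off L []            []           i+j≢L = refl
  coeff2-hom-off L ((c , e) ∷ g) {i} {j} (e<1+L ∷ g<1+L) i+j≢L =
    trans (cong₂ _+_ term (coeff2-hom-off L g g<1+L i+j≢L)) (+-identityˡ _)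
    where
    term : (if (L ∸ e ≡ᵇ i) ∧ (e ≡ᵇ j) then c else 0#) ≡ 0#
    term with e ℕ.≟ j
    ... | yes refl rewrite ≡ᵇ-refl e
                         | ≢⇒≡ᵇ-false (λ L∸e≡i → i+j≢L (trans (cong (ℕ._+ e) (sym L∸e≡i)) (ℕ.m∸n+n≡m (ℕ.s≤s⁻¹ e<1+L)))) = refl
    ... | no  e≢j  rewrite ≢⇒≡ᵇ-false e≢j with L ∸ e ≡ᵇ i
    ...   | true  = refl
    ...   | false = refl

  -- As in `coeffU-map-term`, L₁ and L₂ stand for the pattern lambdas of `mulU` and `mul2`.
  map-hom : ∀ (L₂ : F × ℕ × ℕ → F × ℕ × ℕ) (L₁ : F × ℕ → F × ℕ) c e L M →
            (∀ d x y → L₂ (d , x , y) ≡ (c * d , (L ∸ e) ℕ.+ x , e ℕ.+ y)) →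
            (∀ d k → L₁ (d , k) ≡ (c * d , e ℕ.+ k)) → e ≤ L →
            ∀ h → ExpsBelow (suc M) h → map L₂ (hom M h) ≡ hom (L ℕ.+ M) (map L₁ h)
  map-hom L₂ L₁ c e L M L₂-def L₁-def e≤L []            []                = refl
  map-hom L₂ L₁ c e L M L₂-def L₁-def e≤L ((d , k) ∷ h) (k<1+M ∷ h<1+M)
    rewrite L₂-def d (M ∸ k) k | L₁-def d k =
    cong₂ _∷_ (cong (λ x → c * d , x , e ℕ.+ k) ([L∸e]+[M∸k]≡[L+M]∸[e+k] L M e≤L (ℕ.s≤s⁻¹ k<1+M)))
              (map-hom L₂ L₁ c e L M L₂-def L₁-def e≤L h h<1+M)

  expsBelow-map-term : ∀ (L₁ : F × ℕ → F × ℕ) c e L M → (∀ d k → L₁ (d , k) ≡ (c * d , e ℕ.+ k)) → e ≤ L →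
                       ∀ h → ExpsBelow (suc M) h → ExpsBelow (suc (L ℕ.+ M)) (map L₁ h)
  expsBelow-map-term L₁ c e L M L₁-def e≤L []            []                = []
  expsBelow-map-term L₁ c e L M L₁-def e≤L ((d , k) ∷ h) (k<1+M ∷ h<1+M) rewrite L₁-def d k =
    s≤s (ℕ.+-mono-≤ e≤L (ℕ.s≤s⁻¹ k<1+M)) ∷ expsBelow-map-term L₁ c e L M L₁-def e≤L h h<1+M

  expsBelow-mulU : ∀ L M g h → ExpsBelow (suc L) g → ExpsBelow (suc M) h → ExpsBelow (suc (L ℕ.+ M)) (mulU g h)
  expsBelow-mulU L M []            h []                h<1+M = []
  expsBelow-mulU L M ((c , e) ∷ g) h (e<1+L ∷ g<1+L) h<1+M =
    All.++⁺ (expsBelow-map-term _ c e L M (λ d k → refl) (ℕ.s≤s⁻¹ e<1+L) h h<1+M) (expsBelow-mulU L M g h g<1+L h<1+M)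

  mul2-hom : ∀ L M g h → ExpsBelow (suc L) g → ExpsBelow (suc M) h → mul2 (hom L g) (hom M h) ≡ hom (L ℕ.+ M) (mulU g h)
  mul2-hom L M []            h []                h<1+M = refl
  mul2-hom L M ((c , e) ∷ g) h (e<1+L ∷ g<1+L) h<1+M =
    trans (cong₂ _++_ (map-hom _ _ c e L M (λ d x y → refl) (λ d k → refl) (ℕ.s≤s⁻¹ e<1+L) h h<1+M)
                      (mul2-hom L M g h g<1+L h<1+M))
          (sym (List.map-++ _ (map _ h) (mulU g h)))

  hom-∣₂ : ∀ L m g d h → m ≤ L → ExpsBelow (suc L) g → ExpsBelow (suc m) d → ExpsBelow (suc (L ∸ m)) h →
           g ≈U mulU d h → hom m d ∣₂ hom L g
  hom-∣₂ L m g d h m≤L g<1+L d<1+m h<1+L-m g≈dh =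
    hom (L ∸ m) h , λ i j → trans (coefficient i j) (cong (λ f → coeff2 f i j) (sym (mul2-hom m (L ∸ m) d h d<1+m h<1+L-m)))
    where
    m+[L∸m]≡L : m ℕ.+ (L ∸ m) ≡ L
    m+[L∸m]≡L = ℕ.m+[n∸m]≡n m≤L
    dh<1+L : ExpsBelow (suc (m ℕ.+ (L ∸ m))) (mulU d h)
    dh<1+L = expsBelow-mulU m (L ∸ m) d h d<1+m h<1+L-m
    coefficient : ∀ i j → coeff2 (hom L g) i j ≡ coeff2 (hom (m ℕ.+ (L ∸ m)) (mulU d h)) i j
    coefficient i j with i ℕ.+ j ℕ.≟ L
    ... | yes i+j≡L = trans (coeff2-hom-on L g g<1+L i+j≡L)
                            (trans (g≈dh j) (sym (coeff2-hom-on _ (mulU d h) dh<1+L (trans i+j≡L (sym m+[L∸m]≡L)))))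
    ... | no  i+j≢L = trans (coeff2-hom-off L g g<1+L i+j≢L)
                            (sym (coeff2-hom-off _ (mulU d h) dh<1+L (i+j≢L ∘ (λ eq → trans eq m+[L∸m]≡L))))

  eval2-hom : ∀ L g x t → ExpsBelow (suc L) g → eval2 (hom L g) x (x * t) ≡ x ^ L * evalU g t
  eval2-hom L []            x t []                = sym (zeroʳ _)
  eval2-hom L ((c , e) ∷ g) x t (e<1+L ∷ g<1+L) =
    trans (cong₂ _+_ term (eval2-hom L g x t g<1+L)) (sym (distribˡ _ _ _))
    where
    term : c * x ^ (L ∸ e) * (x * t) ^ e ≡ x ^ L * (c * t ^ e)
    term = begin
      c * x ^ (L ∸ e) * (x * t) ^ e              ≡⟨ cong (c * x ^ (L ∸ e) *_) (^-distrib-* x t e) ⟩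
      (c * x ^ (L ∸ e)) * (x ^ e * t ^ e)        ≡⟨ [ab][cd]≈[ad][bc] c _ _ _ ⟩
      (c * t ^ e) * (x ^ (L ∸ e) * x ^ e)        ≡⟨ *-comm _ _ ⟩
      (x ^ (L ∸ e) * x ^ e) * (c * t ^ e)        ≡⟨ cong (_* (c * t ^ e)) (sym (^-+ x (L ∸ e) e)) ⟩
      x ^ (L ∸ e ℕ.+ e) * (c * t ^ e)            ≡⟨ cong (λ k → x ^ k * (c * t ^ e)) (ℕ.m∸n+n≡m (ℕ.s≤s⁻¹ e<1+L)) ⟩
      x ^ L * (c * t ^ e)                        ∎
      where open ≡-Reasoning

  eval2-hom-≢0 : ∀ L g {x} y → ExpsBelow (suc L) g → x ≢ 0# → eval2 (hom L g) x y ≡ x ^ L * evalU g (x ⁻¹ * y)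
  eval2-hom-≢0 L g {x} y g<1+L x≢0 =
    trans (cong (eval2 (hom L g) x) (sym (x*[x⁻¹*y]≡y y x≢0))) (eval2-hom L g x _ g<1+L)

  eval2-hom-0 : ∀ L g y → ExpsBelow (suc L) g → eval2 (hom L g) 0# y ≡ coeffU g L * y ^ L
  eval2-hom-0 L []            y []                = sym (zeroˡ _)
  eval2-hom-0 L ((c , e) ∷ g) y (e<1+L ∷ g<1+L) =
    trans (cong₂ _+_ term (eval2-hom-0 L g y g<1+L)) (sym (distribʳ _ _ _))
    where
    term : c * 0# ^ (L ∸ e) * y ^ e ≡ (if e ≡ᵇ L then c else 0#) * y ^ L
    term with e ℕ.≟ L
    ... | yes refl rewrite ≡ᵇ-refl e | ℕ.n∸n≡0 e = cong (_* y ^ e) (*-identityʳ c)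
    ... | no  e≢L rewrite ≢⇒≡ᵇ-false e≢L with L ∸ e | ℕ.m<n⇒0<n∸m (ℕ.≤∧≢⇒< (ℕ.s≤s⁻¹ e<1+L) e≢L)
    ...   | suc k | _ = trans (cong (_* y ^ e) (trans (cong (c *_) (zeroˡ _)) (zeroʳ c))) (trans (zeroˡ _) (sym (zeroˡ _)))

  oneU : UPoly
  oneU = (1# , 0) ∷ []

  mulU-oneU : ∀ h → mulU oneU h ≈U h
  mulU-oneU h e = trans (coeffU-mulU oneU h e)
                        (trans (+-identityʳ _) (trans (*-identityˡ _) (coeffU-shiftU-+ h 0 e)))

  mulU-[] : ∀ d → mulU d [] ≡ []
  mulU-[] []      = refl
  mulU-[] (_ ∷ d) = mulU-[] d

  degU≢0⇒NonZeroU : ∀ p → degU p ≢ 0 → NonZeroU p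
  degU≢0⇒NonZeroU p deg≢0 with ≈U[]⊎leadU≢0 p
  ... | inj₁ p≈0    = ⊥-elim (deg≢0 (degU-≈U[] p p≈0))
  ... | inj₂ lead≢0 = degU p , lead≢0

  degU<bound : ∀ {B} p → ExpsBelow B p → NonZeroU p → degU p < B
  degU<bound {B} p p<B p≢0 with degU p ℕ.<? B
  ... | yes deg<B = deg<B
  ... | no  deg≮B = ⊥-elim (leadU≢0 p p≢0 (coeffU-≥bound p p<B (ℕ.≮⇒≥ deg≮B)))

  cofactor-vanishes : ∀ n X d h → ExpsBelow (suc n) X → NonZeroU d → X ≈U mulU d h →
                      ∀ e → suc (n ∸ degU d) ≤ e → coeffU h e ≡ 0#
  cofactor-vanishes n X d h X<1+n d≢0 X≈dh e n∸m<e with coeffU h e ≟ 0#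
  ... | yes hₑ≡0 = hₑ≡0
  ... | no  hₑ≢0 = ⊥-elim (ℕ.<⇒≱ n∸m<e (subst (_≤ n ∸ m) (ℕ.m+n∸m≡n m e) (ℕ.∸-monoˡ-≤ m m+e≤n)))
    where
    m : ℕ
    m = degU d
    dh≢0 : NonZeroU (mulU d h)
    dh≢0 = mulU-NonZeroU d h d≢0 (e , hₑ≢0)
    m+e≤n : m ℕ.+ e ≤ n
    m+e≤n = ℕ.s≤s⁻¹ (begin-strict
      m ℕ.+ e               ≤⟨ ℕ.+-monoʳ-≤ m (≤-degU h hₑ≢0) ⟩
      m ℕ.+ degU h          ≡⟨ sym (degU-mulU d h d≢0 (e , hₑ≢0)) ⟩
      degU (mulU d h)       ≡⟨ sym (degU-cong X (mulU d h) X≈dh) ⟩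
      degU X                <⟨ degU<bound X X<1+n (proj₁ dh≢0 , λ Xₖ≡0 → proj₂ dh≢0 (trans (sym (X≈dh _)) Xₖ≡0)) ⟩
      suc n                 ∎)
      where open ℕ.≤-Reasoning

  ∣U⇒hom-∣₂ : ∀ n m X d → ExpsBelow (suc n) X → ExpsBelow (suc m) d → NonZeroU d → degU d ≡ m → m ≤ n →
              d ∣U X → hom m d ∣₂ hom n X
  ∣U⇒hom-∣₂ n m X d X<1+n d<1+m d≢0 refl m≤n (h , X≈dh) =
    hom-∣₂ n m X d h̃ m≤n X<1+n d<1+m (expsBelow-dense (coeffU h) (suc (n ∸ m)))
           (λ e → trans (X≈dh e) (mulU-cong {d} {d} {h} {h̃} (λ _ → refl) (λ k → sym (h̃≈h k)) e))
    where
    h̃ : UPoly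
    h̃ = dense (coeffU h) (suc (n ∸ m))
    h̃≈h : h̃ ≈U h
    h̃≈h = dense-coeffU h _ (cofactor-vanishes n X d h X<1+n d≢0 X≈dh)

  ∣U⇒degU≤ : ∀ d X → d ∣U X → NonZeroU X → degU d ≤ degU X
  ∣U⇒degU≤ d X (h , X≈dh) (e , Xₑ≢0) with NonZeroU⊎≈U[] d | NonZeroU⊎≈U[] h
  ... | inj₂ d≈0 | _         = ⊥-elim (Xₑ≢0 (trans (X≈dh e) (mulU-cong {d} {[]} {h} {h} d≈0 (λ _ → refl) e)))
  ... | inj₁ _   | inj₂ h≈0  = ⊥-elim (Xₑ≢0 (trans (X≈dh e) (trans (mulU-cong {d} {d} {h} {[]} (λ _ → refl) h≈0 e)
                                                                 (cong (λ r → coeffU r e) (mulU-[] d)))))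
  ... | inj₁ d≢0 | inj₁ h≢0 = begin
    degU d                 ≤⟨ ℕ.m≤m+n (degU d) (degU h) ⟩
    degU d ℕ.+ degU h      ≡⟨ sym (degU-mulU d h d≢0 h≢0) ⟩
    degU (mulU d h)        ≡⟨ sym (degU-cong X (mulU d h) X≈dh) ⟩
    degU X                 ∎
    where open ℕ.≤-Reasoning

  -- A common factor d of P and Q of degree m homogenises to the common factor x ^ m d (y / x).
  Coprime2-hom⇒CoprimeU : ∀ n P Q → ExpsBelow (suc n) P → ExpsBelow (suc n) Q → NonZeroU Q →
                          Coprime2 (hom n P) (hom n Q) → CoprimeU P Q
  Coprime2-hom⇒CoprimeU n P Q P<1+n Q<1+n Q≢0 coprime d d∣P d∣Q with degU d ℕ.≟ 0
  ... | yes deg≡0 = deg≡0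
  ... | no  deg≢0 =
    contradiction (coprime (hom m d̃) (hom-d̃∣₂ P P<1+n d∣P) (hom-d̃∣₂ Q Q<1+n d∣Q) 0 m d̃ₘ≢0) deg≢0
    where
    m : ℕ
    m = degU d
    d̃ : UPoly
    d̃ = dense (coeffU d) (suc m)
    d̃≈d : d̃ ≈U d
    d̃≈d = dense-coeffU d (suc m) (λ e → coeffU-above-degU d)
    dₘ≢0 : coeffU d m ≢ 0#
    dₘ≢0 = leadU≢0 d (degU≢0⇒NonZeroU d deg≢0)
    d̃≢0 : NonZeroU d̃
    d̃≢0 = m , λ d̃ₘ≡0 → dₘ≢0 (trans (sym (d̃≈d m)) d̃ₘ≡0)
    degU-d̃ : degU d̃ ≡ m
    degU-d̃ = degU-cong d̃ d d̃≈d
    m≤n : m ≤ n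
    m≤n = ℕ.s≤s⁻¹ (ℕ.≤-<-trans (∣U⇒degU≤ d Q d∣Q Q≢0) (degU<bound Q Q<1+n Q≢0))
    hom-d̃∣₂ : ∀ X → ExpsBelow (suc n) X → d ∣U X → hom m d̃ ∣₂ hom n X
    hom-d̃∣₂ X X<1+n (h , X≈dh) =
      ∣U⇒hom-∣₂ n m X d̃ X<1+n (expsBelow-dense (coeffU d) (suc m)) d̃≢0 degU-d̃ m≤n
                (h , λ e → trans (X≈dh e) (mulU-cong {d} {d̃} {h} {h} (λ k → sym (d̃≈d k)) (λ _ → refl) e))
    d̃ₘ≢0 : coeff2 (hom m d̃) 0 m ≢ 0#
    d̃ₘ≢0 eq = d̃≢0 .proj₂ (trans (sym (coeff2-hom-on m d̃ (expsBelow-dense (coeffU d) (suc m)) refl)) eq)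

  -- Otherwise x would divide both forms.
  Coprime2-hom⇒coeffU-n≢0 : ∀ n P Q → 1 ≤ n → ExpsBelow n P → ExpsBelow (suc n) Q →
                            Coprime2 (hom n P) (hom n Q) → coeffU Q n ≢ 0#
  Coprime2-hom⇒coeffU-n≢0 n P Q 1≤n P<n Q<1+n coprime Qₙ≡0 =
    contradiction (coprime x x∣₂P (x∣₂ Q Q<1+n Qₙ≡0) 1 0 x₁₀≢0) λ ()
    where
    x : Poly2
    x = hom 1 oneU
    x₁₀≢0 : coeff2 x 1 0 ≢ 0#
    x₁₀≢0 eq = 0≢1 (sym (trans (sym (+-identityʳ 1#)) eq))
    x∣₂ : ∀ X → ExpsBelow (suc n) X → coeffU X n ≡ 0# → x ∣₂ hom n X
    x∣₂ X X<1+n Xₙ≡0 = hom-∣₂ n 1 X oneU X̃ 1≤n X<1+n (s≤s z≤n ∷ [])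
      (subst (λ k → ExpsBelow k X̃) (sym (ℕ.m+[n∸m]≡n 1≤n)) (expsBelow-dense (coeffU X) n))
      (λ e → sym (trans (mulU-oneU X̃ e) (X̃≈X e)))
      where
      X̃ : UPoly
      X̃ = dense (coeffU X) n
      X̃≈X : X̃ ≈U X
      X̃≈X = dense-coeffU X n vanishes
        where
        vanishes : ∀ e → n ≤ e → coeffU X e ≡ 0#
        vanishes e n≤e with n ℕ.≟ e
        ... | yes refl = Xₙ≡0
        ... | no  n≢e  = coeffU-≥bound X X<1+n (ℕ.≤∧≢⇒< n≤e n≢e)
    x∣₂P : x ∣₂ hom n P
    x∣₂P = x∣₂ P (ExpsBelow-mono (ℕ.n≤1+n n) P<n) (coeffU-≥bound P P<n ℕ.≤-refl)

module Plane (𝔽 : FiniteField) where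
  open FiniteField 𝔽
  open FieldTheory 𝔽

  planeMap : Poly2 → Poly2 → F × F → F × F
  planeMap f₁ f₂ (x , y) = eval2 f₁ x y , eval2 f₂ x y

  injective⇒PermutesPlane : ∀ f₁ f₂ → Injective _≡_ _≡_ (planeMap f₁ f₂) → PermutesPlane f₁ f₂
  injective⇒PermutesPlane f₁ f₂ injective u v =
    let p , p↦uv = injective⇒surjective (↔-trans *↔× (enum ×-↔ enum)) (planeMap f₁ f₂) injective (u , v)
    in p , (cong proj₁ p↦uv , cong proj₂ p↦uv) ,
       λ x y f₁≡u f₂≡v → injective (trans (cong₂ _,_ f₁≡u f₂≡v) (sym p↦uv))

module PermutationCriterion (𝔽 : FiniteField) (n : ℕ)
                            (a : Fin n → FiniteField.F 𝔽) (b : Fin (suc n) → FiniteField.F 𝔽) where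
  open FiniteField 𝔽
  open FieldTheory 𝔽
  open FieldProperties 𝔽
  open Univariate 𝔽
  open Homogeneous 𝔽
  open Plane 𝔽

  f₁ f₂ : Poly2
  f₁ = homPoly n n a
  f₂ = homPoly n (suc n) b

  P Q : UPoly
  P = dehom f₁
  Q = dehom f₂

  P<n : ExpsBelow n P
  P<n = expsBelow-dehom-homPoly n n a

  P<1+n : ExpsBelow (suc n) P
  P<1+n = ExpsBelow-mono (ℕ.n≤1+n n) P<n

  Q<1+n : ExpsBelow (suc n) Q
  Q<1+n = expsBelow-dehom-homPoly n (suc n) b

  f₁-line : ∀ {x} y → x ≢ 0# → eval2 f₁ x y ≡ x ^ n * evalU P (x ⁻¹ * y)
  f₁-line {x} y x≢0 =
    trans (cong (λ f → eval2 f x y) (homPoly≡hom-dehom n n a)) (eval2-hom-≢0 n P y P<1+n x≢0)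

  f₂-line : ∀ {x} y → x ≢ 0# → eval2 f₂ x y ≡ x ^ n * evalU Q (x ⁻¹ * y)
  f₂-line {x} y x≢0 =
    trans (cong (λ f → eval2 f x y) (homPoly≡hom-dehom n (suc n) b)) (eval2-hom-≢0 n Q y Q<1+n x≢0)

  f₁-axis : ∀ y → eval2 f₁ 0# y ≡ 0#
  f₁-axis y = begin
    eval2 f₁ 0# y             ≡⟨ cong (λ f → eval2 f 0# y) (homPoly≡hom-dehom n n a) ⟩
    eval2 (hom n P) 0# y      ≡⟨ eval2-hom-0 n P y P<1+n ⟩
    coeffU P n * y ^ n        ≡⟨ cong (_* y ^ n) (coeffU-≥bound P P<n ℕ.≤-refl) ⟩
    0# * y ^ n                ≡⟨ zeroˡ _ ⟩
    0#                        ∎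
    where open ≡-Reasoning

  f₂-axis : ∀ y → eval2 f₂ 0# y ≡ coeffU Q n * y ^ n
  f₂-axis y = trans (cong (λ f → eval2 f 0# y) (homPoly≡hom-dehom n (suc n) b)) (eval2-hom-0 n Q y Q<1+n)

  ratio-planeMap : ∀ {x} y → x ≢ 0# → ratio (eval2 f₁ x y) (eval2 f₂ x y) ≡ induced P Q (just (x ⁻¹ * y))
  ratio-planeMap {x} y x≢0 = begin
    ratio (eval2 f₁ x y) (eval2 f₂ x y)                     ≡⟨ cong₂ ratio (f₁-line y x≢0) (f₂-line y x≢0) ⟩
    ratio (x ^ n * evalU P t) (x ^ n * evalU Q t)           ≡⟨ ratio-scale (^≢0 n x≢0) ⟩
    ratio (evalU P t) (evalU Q t)                           ≡⟨ sym (induced-just P Q t) ⟩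
    induced P Q (just t)                                    ∎
    where
    open ≡-Reasoning
    t : F
    t = x ⁻¹ * y

  ratio-attained : PermutesPlane f₁ f₂ → ∀ u v → u ≢ 0# → ∃[ t ] induced P Q (just t) ≡ ratio u v
  ratio-attained permutes u v u≢0 =
    let (x , y) , (f₁≡u , f₂≡v) , _ = permutes u v
        x≢0 : x ≢ 0#
        x≢0 x≡0 = u≢0 (trans (sym f₁≡u) (trans (cong (λ z → eval2 f₁ z y) x≡0) (f₁-axis y)))
    in x ⁻¹ * y , trans (sym (ratio-planeMap y x≢0)) (cong₂ ratio f₁≡u f₂≡v)

  module _ (1≤n : 1 ≤ n) (coprime : Coprime2 f₁ f₂) where
    private
      coprime-hom : Coprime2 (hom n P) (hom n Q)
      coprime-hom = subst₂ Coprime2 (homPoly≡hom-dehom n n a) (homPoly≡hom-dehom n (suc n) b) coprime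

    Qₙ≢0 : coeffU Q n ≢ 0#
    Qₙ≢0 = Coprime2-hom⇒coeffU-n≢0 n P Q 1≤n P<n Q<1+n coprime-hom

    Q≢0 : NonZeroU Q
    Q≢0 = n , Qₙ≢0

    coprimeU : CoprimeU P Q
    coprimeU = Coprime2-hom⇒CoprimeU n P Q P<1+n Q<1+n Q≢0 coprime-hom

    degU-Q : degU Q ≡ n
    degU-Q = degU-unique Q Qₙ≢0 (λ e n<e → coeffU-≥bound Q Q<1+n n<e)

    degU-P<degU-Q : degU P < degU Q
    degU-P<degU-Q with NonZeroU⊎≈U[] P
    ... | inj₁ P≢0 = subst (degU P <_) (sym degU-Q) (degU<bound P P<n P≢0)
    ... | inj₂ P≈0 = subst₂ _<_ (sym (degU-≈U[] P P≈0)) (sym degU-Q) 1≤n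

    P-Q-no-common-root : ∀ t → ¬ (evalU P t ≡ 0# × evalU Q t ≡ 0#)
    P-Q-no-common-root t (P[t]≡0 , Q[t]≡0) = CoprimeU⇒no-common-root P Q coprimeU P[t]≡0 Q[t]≡0

    degU-P⊔degU-Q : degU P ⊔ degU Q ≡ n
    degU-P⊔degU-Q = trans (ℕ.m≤n⇒m⊔n≡n (ℕ.<⇒≤ degU-P<degU-Q)) degU-Q

    induced-surjective : PermutesPlane f₁ f₂ → StrictlySurjective _≡_ (induced P Q)
    induced-surjective permutes nothing =
      let t , t↦∞ = ratio-attained permutes 1# 0# (0≢1 ∘ sym) in just t , trans t↦∞ (ratio-∞ refl)
    induced-surjective permutes (just s) with s ≟ 0#
    ... | yes s≡0 = nothing , trans (induced-∞ P Q degU-P<degU-Q) (cong just (sym s≡0))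
    ... | no  s≢0 = let t , t↦s = ratio-attained permutes s 1# s≢0 in just t , trans t↦s (ratio-/1 s)

    forward : PermutesPlane f₁ f₂ → DegreePermutesP1 n P Q
    forward permutes =
      P , Q , (Q≢0 , coprimeU , λ _ → refl) , degU-P⊔degU-Q , (injective , strictlySurjective⇒surjective surjective)
      where
      surjective : StrictlySurjective _≡_ (induced P Q)
      surjective = induced-surjective permutes
      injective : Injective _≡_ _≡_ (induced P Q)
      injective = surjective⇒injective (Fin-suc↔Maybe enum) (induced P Q) surjective

    induced-injective : DegreePermutesP1 n P Q → Injective _≡_ _≡_ (induced P Q)
    induced-injective (P′ , Q′ , (Q′≢0 , coprime′ , PQ′≈P′Q) , degree′ , (injective′ , _)) {z} {w} z↦≡w↦ =
      injective′ (trans (sym (agree z)) (trans z↦≡w↦ (agree w)))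
      where
      degU-P′<degU-Q′ : degU P′ < degU Q′
      degU-P′<degU-Q′ with NonZeroU⊎≈U[] P′
      ... | inj₁ P′≢0 = degU-cross-< P Q P′ Q′ Q≢0 Q′≢0 P′≢0 PQ′≈P′Q degU-P<degU-Q
      ... | inj₂ P′≈0 rewrite degU-≈U[] P′ P′≈0 = subst (1 ≤_) (sym degree′) 1≤n

      agree : ∀ z → induced P Q z ≡ induced P′ Q′ z
      agree nothing  = trans (induced-∞ P Q degU-P<degU-Q) (sym (induced-∞ P′ Q′ degU-P′<degU-Q′))
      agree (just t) = begin
        induced P Q (just t)              ≡⟨ induced-just P Q t ⟩
        ratio (evalU P t) (evalU Q t)     ≡⟨ ratio-cross (P-Q-no-common-root t) no-common-root′
                                                         (evalU-mulU-cross P Q P′ Q′ PQ′≈P′Q t) ⟩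
        ratio (evalU P′ t) (evalU Q′ t)   ≡⟨ sym (induced-just P′ Q′ t) ⟩
        induced P′ Q′ (just t)            ∎
        where
        open ≡-Reasoning
        no-common-root′ : ¬ (evalU P′ t ≡ 0# × evalU Q′ t ≡ 0#)
        no-common-root′ (P′[t]≡0 , Q′[t]≡0) = CoprimeU⇒no-common-root P′ Q′ coprime′ P′[t]≡0 Q′[t]≡0

    planeMap-injective-on-axis : gcd n (q ∸ 1) ≡ 1 → ∀ {y₁ y₂} → eval2 f₂ 0# y₁ ≡ eval2 f₂ 0# y₂ → y₁ ≡ y₂
    planeMap-injective-on-axis gcd≡1 {y₁} {y₂} f₂≡ = ^-injective gcd≡1 1≤n (*-cancelˡ Qₙ≢0 (begin
      coeffU Q n * y₁ ^ n     ≡⟨ sym (f₂-axis y₁) ⟩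
      eval2 f₂ 0# y₁          ≡⟨ f₂≡ ⟩
      eval2 f₂ 0# y₂          ≡⟨ f₂-axis y₂ ⟩
      coeffU Q n * y₂ ^ n     ∎))
      where open ≡-Reasoning

    module _ (injective : Injective _≡_ _≡_ (induced P Q)) where
      P[t]≢0 : ∀ t → evalU P t ≢ 0#
      P[t]≢0 t P[t]≡0 with injective {just t} {nothing} (begin
          induced P Q (just t)            ≡⟨ induced-just P Q t ⟩
          ratio (evalU P t) (evalU Q t)   ≡⟨ ratio-finite Q[t]≢0 ⟩
          just (evalU P t * evalU Q t ⁻¹) ≡⟨ cong just (trans (cong (_* evalU Q t ⁻¹) P[t]≡0) (zeroˡ _)) ⟩
          just 0#                         ≡⟨ sym (induced-∞ P Q degU-P<degU-Q) ⟩
          induced P Q nothing             ∎)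
        where
        open ≡-Reasoning
        Q[t]≢0 : evalU Q t ≢ 0#
        Q[t]≢0 Q[t]≡0 = P-Q-no-common-root t (P[t]≡0 , Q[t]≡0)
      ... | ()

      f₁≢0-off-axis : ∀ {x} y → x ≢ 0# → eval2 f₁ x y ≢ 0#
      f₁≢0-off-axis y x≢0 f₁≡0 = x*y≢0 (^≢0 n x≢0) (P[t]≢0 _) (trans (sym (f₁-line y x≢0)) f₁≡0)

      planeMap-injective-off-axis : gcd n (q ∸ 1) ≡ 1 → ∀ {x₁ y₁ x₂ y₂} → x₁ ≢ 0# → x₂ ≢ 0# →
                                    planeMap f₁ f₂ (x₁ , y₁) ≡ planeMap f₁ f₂ (x₂ , y₂) → (x₁ , y₁) ≡ (x₂ , y₂)
      planeMap-injective-off-axis gcd≡1 {x₁} {y₁} {x₂} {y₂} x₁≢0 x₂≢0 same-image = cong₂ _,_ x₁≡x₂ y₁≡y₂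
        where
        open ≡-Reasoning
        t₁≡t₂ : x₁ ⁻¹ * y₁ ≡ x₂ ⁻¹ * y₂
        t₁≡t₂ = Maybe.just-injective (injective (begin
          induced P Q (just (x₁ ⁻¹ * y₁))          ≡⟨ sym (ratio-planeMap y₁ x₁≢0) ⟩
          ratio (eval2 f₁ x₁ y₁) (eval2 f₂ x₁ y₁)  ≡⟨ cong (λ (u , v) → ratio u v) same-image ⟩
          ratio (eval2 f₁ x₂ y₂) (eval2 f₂ x₂ y₂)  ≡⟨ ratio-planeMap y₂ x₂≢0 ⟩
          induced P Q (just (x₂ ⁻¹ * y₂))          ∎))
        x₁≡x₂ : x₁ ≡ x₂
        x₁≡x₂ = ^-injective gcd≡1 1≤n (*-cancelʳ (P[t]≢0 (x₂ ⁻¹ * y₂)) (begin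
          x₁ ^ n * evalU P (x₂ ⁻¹ * y₂)   ≡⟨ cong (λ t → x₁ ^ n * evalU P t) (sym t₁≡t₂) ⟩
          x₁ ^ n * evalU P (x₁ ⁻¹ * y₁)   ≡⟨ sym (f₁-line y₁ x₁≢0) ⟩
          eval2 f₁ x₁ y₁                  ≡⟨ cong proj₁ same-image ⟩
          eval2 f₁ x₂ y₂                  ≡⟨ f₁-line y₂ x₂≢0 ⟩
          x₂ ^ n * evalU P (x₂ ⁻¹ * y₂)   ∎))
        y₁≡y₂ : y₁ ≡ y₂
        y₁≡y₂ = begin
          y₁                      ≡⟨ sym (x*[x⁻¹*y]≡y y₁ x₁≢0) ⟩
          x₁ * (x₁ ⁻¹ * y₁)       ≡⟨ cong₂ _*_ x₁≡x₂ t₁≡t₂ ⟩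
          x₂ * (x₂ ⁻¹ * y₂)       ≡⟨ x*[x⁻¹*y]≡y y₂ x₂≢0 ⟩
          y₂                      ∎

      planeMap-injective : gcd n (q ∸ 1) ≡ 1 → Injective _≡_ _≡_ (planeMap f₁ f₂)
      planeMap-injective gcd≡1 {x₁ , y₁} {x₂ , y₂} same-image with x₁ ≟ 0# | x₂ ≟ 0#
      ... | yes refl | yes refl = cong (0# ,_) (planeMap-injective-on-axis gcd≡1 (cong proj₂ same-image))
      ... | yes refl | no  x₂≢0 =
        ⊥-elim (f₁≢0-off-axis y₂ x₂≢0 (trans (sym (cong proj₁ same-image)) (f₁-axis y₁)))
      ... | no  x₁≢0 | yes refl =
        ⊥-elim (f₁≢0-off-axis y₁ x₁≢0 (trans (cong proj₁ same-image) (f₁-axis y₂)))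
      ... | no  x₁≢0 | no  x₂≢0 = planeMap-injective-off-axis gcd≡1 x₁≢0 x₂≢0 same-image

    backward : gcd n (q ∸ 1) ≡ 1 → DegreePermutesP1 n P Q → PermutesPlane f₁ f₂
    backward gcd≡1 reduced-permutes =
      injective⇒PermutesPlane f₁ f₂ (planeMap-injective (induced-injective reduced-permutes) gcd≡1)

corollary3p7 : (𝔽 : FiniteField) → (n : ℕ) → 1 ≤ n →
    (a : Fin n → FiniteField.F 𝔽) → (b : Fin (suc n) → FiniteField.F 𝔽) →
    let open FieldTheory 𝔽 in
    Coprime2 (homPoly n n a) (homPoly n (suc n) b) →
    gcd n (FiniteField.q 𝔽 ∸ 1) ≡ 1 →
    PermutesPlane (homPoly n n a) (homPoly n (suc n) b)
      ⇔ DegreePermutesP1 n (dehom (homPoly n n a)) (dehom (homPoly n (suc n) b))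
corollary3p7 𝔽 n 1≤n a b coprime gcd≡1 = mk⇔ (forward 1≤n coprime) (backward 1≤n coprime gcd≡1)
  where open PermutationCriterion 𝔽 n a b
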